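{- In the setting described in the context, the following bounds hold. (l) $e(\mathcal T_1,\mathcal T_2)+e(\mathcal M,\mathcal T_2)\le 7t_1t_2+(2+3m)t_2$ if $m\ge1$, and $e(\mathcal T_1,\mathcal T_2)+e(\mathcal M,\mathcal T_2)=0$ (i.e. $\le 0$) if $m=0$. (m) For $j\in\{3,4\}$: $e(\mathcal T_1,\mathcal T_j)+e(\mathcal M,\mathcal T_j)\le 7t_1t_j+(3+3m)t_j$ if $m\ge1$, and $\le 0$ if $m=0$. (n) For $j\in\{3,4\}$: $e(\mathcal T_2,\mathcal T_j)+e(\mathcal I,\mathcal T_j)\le 8t_2t_j+(2+i)t_j$ if $i\ge1$, and $\le 0$ if $i=0$.
   Context: Setting: Let $n,k\ge0$ be integers and let $G$ be an $n$-vertex graph which is edge-maximal subject to not containing $k+1$ pairwise vertex-disjoint triangles. Let $\mathcal T$ be a set of $k$ vertex-disjoint triangles in $G$ and $\mathcal M$ a maximum matching in $G-V(\mathcal T)$, where $\mathcal T$ is chosen among all sets of $k$ vertex-disjoint triangles of $G$ so as to maximise $|\mathcal M|$. Let $\mathcal I$ be the set of vertices of $G$ covered neither by $\mathcal T$ nor by $\mathcal M$. An edge $uv$ sees a vertex $x$ of a triangle $xyz$ if $uvx$ is a triangle of $G$, and sees the triangle $xyz$ if it sees at least one of $x,y,z$. A vertex $u$ sees the edge $xy$ of the triangle $xyz$ (and then sees the triangle) if $uxy$ is a triangle of $G$. Let $\mathcal T_1$ be the set of triangles of $\mathcal T$ seen by at least two edges of $\mathcal M$; let $\mathcal T_2$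 be the set of triangles of $\mathcal T\setminus\mathcal T_1$ seen either by an edge of $\mathcal M$ and at least one vertex of $\mathcal I$, or by two vertices of $\mathcal I$. Start with $D=\mathcal T\setminus(\mathcal T_1\cup\mathcal T_2)$ and $S=\emptyset$; as long as some triangle of $D$ sends at most $8(|D|-1)$ edges to (the vertices of) the other triangles of $D$, move such a triangle from $D$ to $S$; when no such triangle exists set $\mathcal T_3=S$, $\mathcal T_4=D$ (any outcome of this procedure is allowed). Put $m=|\mathcal M|$, $i=|\mathcal I|$, $t_j=|\mathcal T_j|$. $e(\mathcal X,\mathcal Y)$ is the number of edges of $G$ with one endpoint covered by $\mathcal X$ and the other covered by $\mathcal Y$ (for $\mathcal I$, the vertex set $\mathcal I$ itself). -}

module Defs where

open import Data.Nat using (ℕ; zero; suc; _+_; _*_; _∸_; _≤_; _<_; _≤ᵇ_; _<ᵇ_)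
open import Data.Fin using (Fin; toℕ) renaming (zero to fzero; suc to fsuc)
open import Data.Fin.Properties using (_≟_)
open import Data.Bool using (Bool; true; false; _∧_; _∨_; not; if_then_else_)
open import Data.List using (List; []; _∷_)
open import Data.Product using (Σ; _×_; _,_; proj₁; proj₂)
open import Relation.Nullary using (¬_)
open import Relation.Nullary.Decidable using (⌊_⌋)
open import Relation.Binary.PropositionalEquality using (_≡_; _≢_)

count : ∀ {m} → (Fin m → Bool) → ℕ
count {zero}  f = 0
count {suc m} f = (if f fzero then 1 else 0) + count (λ j → f (fsuc j))

anyFin : ∀ {m} → (Fin m → Bool) → Bool
anyFin {zero}  f = false
anyFin {suc m} f = f fzero ∨ anyFin (λ j → f (fsuc j))

sumFin : ∀ {m} → (Fin m → ℕ) → ℕ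
sumFin {zero}  f = 0
sumFin {suc m} f = f fzero + sumFin (λ j → f (fsuc j))

eqB : ∀ {n} → Fin n → Fin n → Bool
eqB x y = ⌊ x ≟ y ⌋

Adj : ℕ → Set
Adj n = Fin n → Fin n → Bool

IsSimpleGraph : ∀ {n} → Adj n → Set
IsSimpleGraph {n} adj = (∀ x y → adj x y ≡ adj y x) × (∀ x → adj x x ≡ false)

addEdge : ∀ {n} → Adj n → Fin n → Fin n → Adj n
addEdge adj u v x y = adj x y ∨ ((eqB x u ∧ eqB y v) ∨ (eqB x v ∧ eqB y u))

-- number of edges of G with one endpoint in A and the other in B
-- (each edge {u,v} counted once, via toℕ u < toℕ v)
e : ∀ {n} → Adj n → (Fin n → Bool) → (Fin n → Bool) → ℕ
e adj A B = sumFin (λ u → count (λ v →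
  (toℕ u <ᵇ toℕ v) ∧ adj u v ∧ ((A u ∧ B v) ∨ (B u ∧ A v))))

Tri : ℕ → Set
Tri n = Fin n × Fin n × Fin n

inTri : ∀ {n} → Tri n → Fin n → Bool
inTri (x , y , z) v = eqB v x ∨ eqB v y ∨ eqB v z

isTriB : ∀ {n} → Adj n → Fin n → Fin n → Fin n → Bool
isTriB adj x y z = adj x y ∧ adj y z ∧ adj x z

IsTriangle : ∀ {n} → Adj n → Tri n → Set
IsTriangle adj (x , y , z) = isTriB adj x y z ≡ true

IsDisjointTriangles : ∀ {n k} → Adj n → (Fin k → Tri n) → Set
IsDisjointTriangles {n} {k} adj T =
  (∀ i → IsTriangle adj (T i)) ×
  (∀ i j → i ≢ j → ∀ v → inTri (T i) v ≡ true → inTri (T j) v ≡ false)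

HasDisjointTriangles : ∀ {n} → Adj n → ℕ → Set
HasDisjointTriangles {n} adj k = Σ (Fin k → Tri n) (IsDisjointTriangles adj)

EdgeMaximal : ∀ {n} → Adj n → ℕ → Set
EdgeMaximal adj k =
  ¬ HasDisjointTriangles adj (suc k) ×
  (∀ u v → u ≢ v → adj u v ≡ false → HasDisjointTriangles (addEdge adj u v) (suc k))

covTris : ∀ {n k} → (Fin k → Tri n) → (Fin k → Bool) → Fin n → Bool
covTris T P v = anyFin (λ i → P i ∧ inTri (T i) v)

Edge : ℕ → Set
Edge n = Fin n × Fin n

inEdge : ∀ {n} → Edge n → Fin n → Bool
inEdge (a , b) v = eqB v a ∨ eqB v b

IsMatchingAvoiding : ∀ {n k m} → Adj n → (Fin k → Tri n) → (Fin m → Edge n) → Set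
IsMatchingAvoiding adj T M =
  (∀ j → adj (proj₁ (M j)) (proj₂ (M j)) ≡ true) ×
  (∀ j j' → j ≢ j' → ∀ v → inEdge (M j) v ≡ true → inEdge (M j') v ≡ false) ×
  (∀ j v → inEdge (M j) v ≡ true → covTris T (λ _ → true) v ≡ false)

IsMaximumMatching : ∀ {n k m} → Adj n → (Fin k → Tri n) → (Fin m → Edge n) → Set
IsMaximumMatching {n} {k} {m} adj T M =
  IsMatchingAvoiding adj T M ×
  (∀ m' (M' : Fin m' → Edge n) → IsMatchingAvoiding adj T M' → m' ≤ m)

-- T was chosen among all families of k disjoint triangles so as to
-- maximise the size of a maximum matching of G - V(T)
TChoiceOptimal : ∀ {n k} → Adj n → (Fin k → Tri n) → ℕ → Set
TChoiceOptimal {n} {k} adj T m =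
  ∀ (T' : Fin k → Tri n) → IsDisjointTriangles adj T' →
  ∀ m' (M' : Fin m' → Edge n) → IsMatchingAvoiding adj T' M' → m' ≤ m

covM : ∀ {n m} → (Fin m → Edge n) → Fin n → Bool
covM M v = anyFin (λ j → inEdge (M j) v)

inI : ∀ {n k m} → (Fin k → Tri n) → (Fin m → Edge n) → Fin n → Bool
inI T M v = not (covTris T (λ _ → true) v) ∧ not (covM M v)

edgeSeesTri : ∀ {n} → Adj n → Edge n → Tri n → Bool
edgeSeesTri adj (u , v) (x , y , z) =
  isTriB adj u v x ∨ isTriB adj u v y ∨ isTriB adj u v z

vertexSeesTri : ∀ {n} → Adj n → Fin n → Tri n → Bool
vertexSeesTri adj u (x , y , z) =
  isTriB adj u x y ∨ isTriB adj u y z ∨ isTriB adj u x z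

nMsee : ∀ {n k m} → Adj n → (Fin k → Tri n) → (Fin m → Edge n) → Fin k → ℕ
nMsee adj T M i = count (λ j → edgeSeesTri adj (M j) (T i))

nIsee : ∀ {n k m} → Adj n → (Fin k → Tri n) → (Fin m → Edge n) → Fin k → ℕ
nIsee adj T M i = count (λ u → inI T M u ∧ vertexSeesTri adj u (T i))

inT1 : ∀ {n k m} → Adj n → (Fin k → Tri n) → (Fin m → Edge n) → Fin k → Bool
inT1 adj T M i = 2 ≤ᵇ nMsee adj T M i

inT2 : ∀ {n k m} → Adj n → (Fin k → Tri n) → (Fin m → Edge n) → Fin k → Bool
inT2 adj T M i =
  not (inT1 adj T M i) ∧
  (((1 ≤ᵇ nMsee adj T M i) ∧ (1 ≤ᵇ nIsee adj T M i)) ∨ (2 ≤ᵇ nIsee adj T M i))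

D₀ : ∀ {n k m} → Adj n → (Fin k → Tri n) → (Fin m → Edge n) → Fin k → Bool
D₀ adj T M i = not (inT1 adj T M i) ∧ not (inT2 adj T M i)

sends : ∀ {n k} → Adj n → (Fin k → Tri n) → (Fin k → Bool) → Fin k → ℕ
sends adj T D i = e adj (inTri (T i)) (covTris T (λ j → D j ∧ not (eqB i j)))

removeIdx : ∀ {k} → (Fin k → Bool) → Fin k → Fin k → Bool
removeIdx D i j = D j ∧ not (eqB i j)

-- ValidRun adj T D s : starting from the current D, the procedure may move
-- the triangles listed in s (in this order) from D to S and then stop.
data ValidRun {n k} (adj : Adj n) (T : Fin k → Tri n) : (Fin k → Bool) → List (Fin k) → Set where
  stop : ∀ {D} → (∀ i → D i ≡ true → 8 * (count D ∸ 1) < sends adj T D i) →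
         ValidRun adj T D []
  move : ∀ {D i s} → D i ≡ true → sends adj T D i ≤ 8 * (count D ∸ 1) →
         ValidRun adj T (removeIdx D i) s → ValidRun adj T D (i ∷ s)

finalD : ∀ {k} → (Fin k → Bool) → List (Fin k) → Fin k → Bool
finalD D []      = D
finalD D (i ∷ s) = finalD (removeIdx D i) s

inList : ∀ {k} → List (Fin k) → Fin k → Bool
inList []      i = false
inList (j ∷ s) i = eqB i j ∨ inList s i

BoundsLMN : ∀ {n k m} → Adj n → (Fin k → Tri n) → (Fin m → Edge n) → List (Fin k) → Set
BoundsLMN {n} {k} {m} adj T M s =
  ((1 ≤ m → eTM V1 V2 ≤ 7 * t1 * t2 + (2 + 3 * m) * t2) ×
   (m ≡ 0 → eTM V1 V2 ≡ 0)) ×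
  ((1 ≤ m → eTM V1 V3 ≤ 7 * t1 * t3 + (3 + 3 * m) * t3) ×
   (m ≡ 0 → eTM V1 V3 ≤ 0)) ×
  ((1 ≤ m → eTM V1 V4 ≤ 7 * t1 * t4 + (3 + 3 * m) * t4) ×
   (m ≡ 0 → eTM V1 V4 ≤ 0)) ×
  ((1 ≤ i → eTI V2 V3 ≤ 8 * t2 * t3 + (2 + i) * t3) ×
   (i ≡ 0 → eTI V2 V3 ≤ 0)) ×
  ((1 ≤ i → eTI V2 V4 ≤ 8 * t2 * t4 + (2 + i) * t4) ×
   (i ≡ 0 → eTI V2 V4 ≤ 0))
  where
  P1 P2 P3 P4 : Fin k → Bool
  P1 = inT1 adj T M
  P2 = inT2 adj T M
  P3 = inList s
  P4 = finalD (D₀ adj T M) s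
  V1 V2 V3 V4 : Fin n → Bool
  V1 = covTris T P1
  V2 = covTris T P2
  V3 = covTris T P3
  V4 = covTris T P4
  t1 t2 t3 t4 i : ℕ
  t1 = count P1
  t2 = count P2
  t3 = count P3
  t4 = count P4
  i  = count (inI T M)
  eTM : (Fin n → Bool) → (Fin n → Bool) → ℕ
  eTM X Y = e adj X Y + e adj (covM M) Y
  eTI : (Fin n → Bool) → (Fin n → Bool) → ℕ
  eTI X Y = e adj X Y + e adj (inI T M) Y

-- The bounds are proved one triangle Y of the target class at a time.  A triangle of T sends at most
-- 9 edges to Y, an edge of M at most 6, and only 3 if it does not see Y, and a vertex of I at most 3,
-- and only 1 if it does not see Y.  The surplus is controlled by exchange arguments: the seers of a
-- triangle of T₁ sending 8 edges to Y (of T₂ sending all 9) can be recombined with these triangles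
-- into one triangle more than they replace, or into as many while freeing an edge disjoint from M.
-- As G has no k + 1 disjoint triangles and T maximises the matching number of G - V(T), at most one
-- triangle of T₁ (of T₂) is that dense towards Y, and then no edge of M sees Y (only one vertex of I
-- has neighbours in Y).

module Submission where

open import Defs
open import Data.Bool using (Bool; true; false; _∧_; _∨_; not; if_then_else_)
open import Data.Bool.Properties using (T-≡; ¬-not; ∨-zeroʳ; ∧-zeroʳ)
open import Data.Empty using (⊥; ⊥-elim)
open import Data.Fin using (Fin; toℕ) renaming (zero to fzero; suc to fsuc)
open import Data.Fin.Properties using (_≟_; any?)
open import Data.List using (List; []; _∷_)
open import Data.Nat using (ℕ; zero; suc; _+_; _*_; _≤_; _<_; _≤ᵇ_; _<ᵇ_; z≤n; s≤s)
open import Data.Nat.Properties hiding (_≟_)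
open import Data.Nat.Tactic.RingSolver using (solve-∀)
open import Algebra.Properties.CommutativeSemigroup +-commutativeSemigroup using (interchange)
open import Data.Product using (∃-syntax; _×_; _,_; proj₁; proj₂)
open import Data.Sum using (_⊎_; inj₁; inj₂)
open import Function using (_∘_; Equivalence)
open import Relation.Nullary using (¬_; yes; no)
open import Relation.Nullary.Decidable using (dec-true; dec-false; isYes≗does; toWitness; ⌊⌋-map′; _×-dec_)
open import Relation.Binary.PropositionalEquality

bit : Bool → ℕ
bit b = if b then 1 else 0

∨-introˡ : ∀ {a b} → a ≡ true → a ∨ b ≡ true
∨-introˡ refl = refl

∨-introʳ : ∀ a {b} → b ≡ true → a ∨ b ≡ true
∨-introʳ a refl = ∨-zeroʳ a

∨-intro₂ : ∀ a {b c} → b ≡ true → a ∨ b ∨ c ≡ true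
∨-intro₂ a b = ∨-introʳ a (∨-introˡ b)

∨-intro₃ : ∀ a b {c} → c ≡ true → a ∨ b ∨ c ≡ true
∨-intro₃ a b c = ∨-introʳ a (∨-introʳ b c)

∧-intro : ∀ {a b} → a ≡ true → b ≡ true → a ∧ b ≡ true
∧-intro refl refl = refl

∧-fst : ∀ a {b} → a ∧ b ≡ true → a ≡ true
∧-fst true _ = refl

∧-snd : ∀ a {b} → a ∧ b ≡ true → b ≡ true
∧-snd true h = h

∧-assocʳ : ∀ a b {c} → (a ∧ b) ∧ c ≡ true → a ∧ b ∧ c ≡ true
∧-assocʳ true b h = h

∧-rotate : ∀ a b {c c′} → c ≡ c′ → a ∧ b ∧ c ≡ true → b ∧ a ∧ c′ ≡ true
∧-rotate true  true  refl h = h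
∧-rotate true  false _    ()

not-true : ∀ {b} → not b ≡ true → b ≡ false
not-true {false} _ = refl

true≢false : true ≢ false
true≢false ()

eqB-refl : ∀ {k} (a : Fin k) → eqB a a ≡ true
eqB-refl a = trans (isYes≗does (a ≟ a)) (dec-true (a ≟ a) refl)

eqB⇒≡ : ∀ {k} {a b : Fin k} → eqB a b ≡ true → a ≡ b
eqB⇒≡ h = toWitness (Equivalence.from T-≡ h)

≢⇒eqB-false : ∀ {k} {a b : Fin k} → a ≢ b → eqB a b ≡ false
≢⇒eqB-false {a = a} {b} a≢b = trans (isYes≗does (a ≟ b)) (dec-false (a ≟ b) a≢b)

eqB-suc : ∀ {k} (a b : Fin k) → eqB (fsuc a) (fsuc b) ≡ eqB a b
eqB-suc a b = ⌊⌋-map′ _ _ (a ≟ b)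

eqB-false⇒≢ : ∀ {k} {a b : Fin k} → eqB a b ≡ false → a ≢ b
eqB-false⇒≢ {a = a} h refl = true≢false (trans (sym (eqB-refl a)) h)

≤ᵇ-true : ∀ {a b} → (a ≤ᵇ b) ≡ true → a ≤ b
≤ᵇ-true {a} {b} h = ≤ᵇ⇒≤ a b (Equivalence.from T-≡ h)

≤ᵇ-false : ∀ {a b} → (a ≤ᵇ b) ≡ false → b < a
≤ᵇ-false {a} {b} h = ≰⇒> (λ a≤b → true≢false (trans (sym (Equivalence.to T-≡ (≤⇒≤ᵇ a≤b))) h))

-- Finite sums and counts

sum-cong : ∀ {m} {f g : Fin m → ℕ} → (∀ j → f j ≡ g j) → sumFin f ≡ sumFin g
sum-cong {zero}  h = refl
sum-cong {suc m} h = cong₂ _+_ (h fzero) (sum-cong (h ∘ fsuc))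

sum-mono : ∀ {m} {f g : Fin m → ℕ} → (∀ j → f j ≤ g j) → sumFin f ≤ sumFin g
sum-mono {zero}  h = z≤n
sum-mono {suc m} h = +-mono-≤ (h fzero) (sum-mono (h ∘ fsuc))

sum-+ : ∀ {m} (f g : Fin m → ℕ) → sumFin (λ j → f j + g j) ≡ sumFin f + sumFin g
sum-+ {zero}  f g = refl
sum-+ {suc m} f g = trans (cong (f fzero + g fzero +_) (sum-+ (f ∘ fsuc) (g ∘ fsuc)))
                          (interchange (f fzero) (g fzero) _ _)

sum-const : ∀ {m} c → sumFin {m} (λ _ → c) ≡ m * c
sum-const {zero}  c = refl
sum-const {suc m} c = cong (c +_) (sum-const {m} c)

sum-zero : ∀ {m} {f : Fin m → ℕ} → (∀ j → f j ≡ 0) → sumFin f ≡ 0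
sum-zero {m} h = trans (sum-cong h) (trans (sum-const {m} 0) (*-zeroʳ m))

sum-comm : ∀ {m k} (f : Fin m → Fin k → ℕ) →
           sumFin (λ i → sumFin (f i)) ≡ sumFin (λ j → sumFin (λ i → f i j))
sum-comm {zero}  {k} f = trans (sym (*-zeroʳ k)) (sym (sum-const {k} 0))
sum-comm {suc m} {k} f = trans (cong (sumFin (f fzero) +_) (sum-comm (f ∘ fsuc)))
                               (sym (sum-+ (f fzero) (λ j → sumFin (λ i → f (fsuc i) j))))

count≡sum : ∀ {m} (f : Fin m → Bool) → count f ≡ sumFin (λ j → bit (f j))
count≡sum {zero}  f = refl
count≡sum {suc m} f = cong (bit (f fzero) +_) (count≡sum (f ∘ fsuc))

sum-*ʳ : ∀ {m} (f : Fin m → ℕ) c → sumFin (λ j → f j * c) ≡ sumFin f * c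
sum-*ʳ {zero}  f c = refl
sum-*ʳ {suc m} f c = trans (cong (f fzero * c +_) (sum-*ʳ (f ∘ fsuc) c))
                           (sym (*-distribʳ-+ c (f fzero) _))

count-mono : ∀ {m} {f g : Fin m → Bool} → (∀ j → f j ≡ true → g j ≡ true) → count f ≤ count g
count-mono {zero}                h = z≤n
count-mono {suc m} {f} {g}       h with f fzero in f₀ | g fzero in g₀
... | false | _     = ≤-trans (count-mono (h ∘ fsuc)) (m≤n+m _ _)
... | true  | true  = s≤s (count-mono (h ∘ fsuc))
... | true  | false = ⊥-elim (true≢false (trans (sym (h fzero f₀)) g₀))

count-empty : ∀ {m} {f : Fin m → Bool} → (∀ j → f j ≡ false) → count f ≡ 0
count-empty {zero}  h = refl
count-empty {suc m} {f} h rewrite h fzero = count-empty (h ∘ fsuc)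

count-∨ : ∀ {m} (f g : Fin m → Bool) → count (λ j → f j ∨ g j) ≤ count f + count g
count-∨ {zero}  f g = z≤n
count-∨ {suc m} f g = ≤-trans (+-mono-≤ (bit-∨ (f fzero) (g fzero)) (count-∨ (f ∘ fsuc) (g ∘ fsuc)))
                              (≤-reflexive (interchange (bit (f fzero)) (bit (g fzero)) _ _))
  where
  bit-∨ : ∀ a b → bit (a ∨ b) ≤ bit a + bit b
  bit-∨ true  b     = s≤s z≤n
  bit-∨ false b     = ≤-refl

count-disjoint : ∀ {m} {f g h : Fin m → Bool} → (∀ j → f j ≡ true → g j ≡ true → ⊥) →
                 (∀ j → f j ≡ true → h j ≡ true) → (∀ j → g j ≡ true → h j ≡ true) →
                 count f + count g ≤ count h
count-disjoint {zero} _ _ _ = z≤n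
count-disjoint {suc m} {f} {g} {h} fg fh gh with f fzero in f₀ | g fzero in g₀
... | true  | true  = ⊥-elim (fg fzero f₀ g₀)
... | true  | false rewrite fh fzero f₀ = s≤s (count-disjoint (fg ∘ fsuc) (fh ∘ fsuc) (gh ∘ fsuc))
... | false | true  rewrite gh fzero g₀ =
  ≤-trans (≤-reflexive (+-suc _ _)) (s≤s (count-disjoint (fg ∘ fsuc) (fh ∘ fsuc) (gh ∘ fsuc)))
... | false | false = ≤-trans (count-disjoint (fg ∘ fsuc) (fh ∘ fsuc) (gh ∘ fsuc)) (m≤n+m _ _)

count-cong : ∀ {m} {f g : Fin m → Bool} → (∀ j → f j ≡ g j) → count f ≡ count g
count-cong {zero}  h = refl
count-cong {suc m} h = cong₂ _+_ (cong bit (h fzero)) (count-cong (h ∘ fsuc))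

count-singleton : ∀ {m} (a : Fin m) → count (λ j → eqB j a) ≡ 1
count-singleton {suc m} fzero = cong suc (count-empty {m} (λ _ → refl))
count-singleton         (fsuc a) = trans (count-cong (λ j → eqB-suc j a)) (count-singleton a)

count-positive : ∀ {m} {f : Fin m → Bool} {j} → f j ≡ true → 1 ≤ count f
count-positive {f = f} {j} fj =
  ≤-trans (≤-reflexive (sym (count-singleton j)))
          (count-mono {f = λ x → eqB x j} (λ x x≡j → subst (λ y → f y ≡ true) (sym (eqB⇒≡ x≡j)) fj))

count-witness : ∀ {m} {f : Fin m → Bool} → 1 ≤ count f → ∃[ j ] f j ≡ true
count-witness {f = f} 1≤ with any? (λ j → f j Data.Bool.≟ true)
... | yes w = w
... | no ¬w with () ← ≤-trans 1≤ (≤-reflexive (count-empty (λ j → ¬-not (λ fj → ¬w (j , fj)))))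

count-another : ∀ {m} {f : Fin m → Bool} → 2 ≤ count f → ∀ a → ∃[ j ] j ≢ a × f j ≡ true
count-another {f = f} 2≤ a with count-witness {f = λ j → f j ∧ not (eqB j a)} 1≤
  where
  split : ∀ j → f j ≡ true → (f j ∧ not (eqB j a)) ∨ eqB j a ≡ true
  split j fj with eqB j a
  ... | true  = ∨-zeroʳ _
  ... | false rewrite fj = refl
  1≤ : 1 ≤ count (λ j → f j ∧ not (eqB j a))
  1≤ = ≤-pred (≤-trans 2≤ (≤-trans (count-mono split)
         (≤-trans (count-∨ (λ j → f j ∧ not (eqB j a)) (λ j → eqB j a))
         (≤-reflexive (trans (cong (count (λ j → f j ∧ not (eqB j a)) +_) (count-singleton a)) (+-comm _ 1))))))
... | j , h = j , eqB-false⇒≢ (not-true (∧-snd (f j) h)) , ∧-fst (f j) h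

count-≥2 : ∀ {m} {f : Fin m → Bool} {a b} → a ≢ b → f a ≡ true → f b ≡ true → 2 ≤ count f
count-≥2 {f = f} {a} {b} a≢b fa fb =
  ≤-trans (≤-reflexive (sym (cong₂ _+_ (count-singleton a) (count-singleton b))))
          (count-disjoint {f = λ j → eqB j a} {g = λ j → eqB j b}
            (λ j ja jb → a≢b (trans (sym (eqB⇒≡ ja)) (eqB⇒≡ jb)))
            (λ j ja → subst (λ x → f x ≡ true) (sym (eqB⇒≡ ja)) fa)
            (λ j jb → subst (λ x → f x ≡ true) (sym (eqB⇒≡ jb)) fb))

count-≤1 : ∀ {m} {f : Fin m → Bool} → (∀ a b → f a ≡ true → f b ≡ true → a ≡ b) → count f ≤ 1
count-≤1 {f = f} unique with 2 ≤? count f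
... | no 2≰ = ≤-pred (≰⇒> 2≰)
... | yes 2≤ with count-witness (≤-trans (s≤s z≤n) 2≤)
...   | a , fa with count-another 2≤ a
...     | b , b≢a , fb = ⊥-elim (b≢a (unique b a fb fa))

sum-bit* : ∀ {m} (Q : Fin m → Bool) c → sumFin (λ j → bit (Q j) * c) ≡ count Q * c
sum-bit* Q c = trans (sum-*ʳ (λ j → bit (Q j)) c) (cong (_* c) (sym (count≡sum Q)))

sum-≤-count* : ∀ {m} {f : Fin m → ℕ} (Q : Fin m → Bool) c →
               (∀ j → f j ≤ bit (Q j) * c) → sumFin f ≤ count Q * c
sum-≤-count* Q c h = ≤-trans (sum-mono h) (≤-reflexive (sum-bit* Q c))

sum-≤-counts : ∀ {m} {f : Fin m → ℕ} (Q R : Fin m → Bool) c d →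
               (∀ j → f j ≤ bit (Q j) * c + bit (R j) * d) → sumFin f ≤ count Q * c + count R * d
sum-≤-counts Q R c d h =
  ≤-trans (sum-mono h) (≤-reflexive (trans (sum-+ (λ j → bit (Q j) * c) (λ j → bit (R j) * d))
                                           (cong₂ _+_ (sum-bit* Q c) (sum-bit* R d))))

sum-≤-affine : ∀ {m} {f : Fin m → ℕ} (R : Fin m → Bool) c d →
               (∀ j → f j ≤ c + bit (R j) * d) → sumFin f ≤ m * c + count R * d
sum-≤-affine {m} R c d h =
  ≤-trans (sum-mono h) (≤-reflexive (trans (sum-+ (λ _ → c) (λ j → bit (R j) * d))
                                           (cong₂ _+_ (sum-const {m} c) (sum-bit* R d))))

≤-bit* : ∀ {Q x} c → (Q ≡ true → x ≤ c) → (Q ≡ false → x ≡ 0) → x ≤ bit Q * c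
≤-bit* {false} c _ x≡0 = ≤-reflexive (x≡0 refl)
≤-bit* {true}  c x≤c _ = ≤-trans (x≤c refl) (≤-reflexive (sym (+-identityʳ c)))

anyFin-none : ∀ {m} {f : Fin m → Bool} → (∀ j → f j ≡ false) → anyFin f ≡ false
anyFin-none {zero}  h = refl
anyFin-none {suc m} h rewrite h fzero = anyFin-none (h ∘ fsuc)

anyFin-false : ∀ {m} (f : Fin m → Bool) → anyFin f ≡ false → ∀ j → f j ≡ false
anyFin-false f h fzero    with f fzero
... | false = refl
anyFin-false f h (fsuc j) with f fzero
... | false = anyFin-false (f ∘ fsuc) h j

-- Counting edges between vertex sets

pairs : ∀ {n} → (Fin n → Fin n → Bool) → ℕ
pairs R = sumFin λ u → count (R u)

module _ {n : ℕ} where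

  pairs-mono : {R S : Fin n → Fin n → Bool} → (∀ u v → R u v ≡ true → S u v ≡ true) →
               pairs R ≤ pairs S
  pairs-mono h = sum-mono (λ u → count-mono (h u))

  pairs-∨ : (R S : Fin n → Fin n → Bool) → pairs (λ u v → R u v ∨ S u v) ≤ pairs R + pairs S
  pairs-∨ R S = ≤-trans (sum-mono (λ u → count-∨ (R u) (S u)))
                        (≤-reflexive (sum-+ (λ u → count (R u)) (λ u → count (S u))))

  pairs-disjoint : {R S U : Fin n → Fin n → Bool} → (∀ u v → R u v ≡ true → S u v ≡ true → ⊥) →
                   (∀ u v → R u v ≡ true → U u v ≡ true) → (∀ u v → S u v ≡ true → U u v ≡ true) →
                   pairs R + pairs S ≤ pairs U
  pairs-disjoint {R} {S} RS RU SU =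
    ≤-trans (≤-reflexive (sym (sum-+ (λ u → count (R u)) (λ u → count (S u)))))
            (sum-mono (λ u → count-disjoint (RS u) (RU u) (SU u)))

  pairs-transpose : (R : Fin n → Fin n → Bool) → pairs R ≡ pairs (λ u v → R v u)
  pairs-transpose R = begin
    sumFin (λ u → count (R u))                           ≡⟨ sum-cong (λ u → count≡sum (R u)) ⟩
    sumFin (λ u → sumFin (λ v → bit (R u v)))            ≡⟨ sum-comm (λ u v → bit (R u v)) ⟩
    sumFin (λ v → sumFin (λ u → bit (R u v)))            ≡⟨ sum-cong (λ v → count≡sum (λ u → R u v)) ⟨
    sumFin (λ v → count (λ u → R u v))                   ∎
    where open ≡-Reasoning

arcs : ∀ {n} → Adj n → (Fin n → Bool) → (Fin n → Bool) → ℕ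
arcs adj A B = pairs λ u v → A u ∧ B v ∧ adj u v

deg : ∀ {n} → Adj n → (Fin n → Bool) → Fin n → ℕ
deg adj B u = count λ v → B v ∧ adj u v

Symmetric : ∀ {n} → Adj n → Set
Symmetric adj = ∀ x y → adj x y ≡ adj y x

module _ {n : ℕ} {adj : Adj n} (adj-sym : Symmetric adj) where

  arcs-swap : (A B : Fin n → Bool) → arcs adj A B ≤ arcs adj B A
  arcs-swap A B = ≤-trans (≤-reflexive (pairs-transpose (λ u v → A u ∧ B v ∧ adj u v)))
    (pairs-mono (λ u v → ∧-rotate (A v) (B u) (adj-sym v u)))

  e-≤-arcs : (A B : Fin n → Bool) → e adj A B ≤ arcs adj A B
  e-≤-arcs A B = begin
    e adj A B                                    ≤⟨ pairs-mono (λ u v → split (u <ᴮ v) (adj u v) _ _) ⟩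
    pairs (λ u v → forward u v ∨ backward u v)   ≤⟨ pairs-∨ forward backward ⟩
    pairs forward + pairs backward               ≡⟨ cong (pairs forward +_) (pairs-transpose backward) ⟩
    pairs forward + pairs (λ u v → backward v u) ≤⟨ pairs-disjoint <ᴮ-asym forward⊆arcs backward⊆arcs ⟩
    arcs adj A B                                 ∎
    where
    open ≤-Reasoning
    _<ᴮ_ : Fin n → Fin n → Bool
    u <ᴮ v = toℕ u <ᵇ toℕ v
    forward backward : Fin n → Fin n → Bool
    forward  u v = (u <ᴮ v) ∧ (A u ∧ B v) ∧ adj u v
    backward u v = (u <ᴮ v) ∧ (B u ∧ A v) ∧ adj u v
    split : ∀ l d x y → l ∧ d ∧ (x ∨ y) ≡ true → (l ∧ x ∧ d) ∨ (l ∧ y ∧ d) ≡ true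
    split true  true  true  y     _ = refl
    split true  true  false true  _ = refl
    split false _     _     _     ()
    split true  false _     _     ()
    split true  true  false false ()
    <ᴮ-asym : ∀ u v → forward u v ≡ true → backward v u ≡ true → ⊥
    <ᴮ-asym u v f b = <-asym (<ᵇ⇒< (toℕ u) (toℕ v) (Equivalence.from T-≡ (∧-fst (u <ᴮ v) f)))
                             (<ᵇ⇒< (toℕ v) (toℕ u) (Equivalence.from T-≡ (∧-fst (v <ᴮ u) b)))
    forward⊆arcs : ∀ u v → forward u v ≡ true → A u ∧ B v ∧ adj u v ≡ true
    forward⊆arcs u v f = ∧-assocʳ (A u) (B v) (∧-snd (u <ᴮ v) f)
    backward⊆arcs : ∀ u v → backward v u ≡ true → A u ∧ B v ∧ adj u v ≡ true
    backward⊆arcs u v b = ∧-rotate (B v) (A u) (adj-sym v u) (∧-assocʳ (B v) (A u) (∧-snd (v <ᴮ u) b))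

  e-emptyˡ : {A : Fin n → Bool} → (∀ u → A u ≡ false) → ∀ B → e adj A B ≡ 0
  e-emptyˡ {A} A∅ B = n≤0⇒n≡0 (≤-trans (e-≤-arcs A B) (≤-reflexive (sum-zero (λ u →
    count-empty (λ v → cong (λ a → a ∧ B v ∧ adj u v) (A∅ u))))))

  arcs-⋃ˡ : ∀ {k} (F : Fin k → Fin n → Bool) (B : Fin n → Bool) →
            arcs adj (λ u → anyFin (λ i → F i u)) B ≤ sumFin (λ i → arcs adj (F i) B)
  arcs-⋃ˡ F B = ≤-trans (sum-mono (λ u → count-anyFin (λ i → F i u) (λ v → B v ∧ adj u v)))
                        (≤-reflexive (sum-comm (λ u i → count (λ v → F i u ∧ B v ∧ adj u v))))
    where
    count-anyFin : ∀ {k} (h : Fin k → Bool) (c : Fin n → Bool) →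
                   count (λ v → anyFin h ∧ c v) ≤ sumFin (λ i → count (λ v → h i ∧ c v))
    count-anyFin {zero}  h c = ≤-reflexive (count-empty {n} (λ _ → refl))
    count-anyFin {suc k} h c with h fzero
    ... | true  = m≤m+n (count c) _
    ... | false = ≤-trans (count-anyFin (h ∘ fsuc) c) (m≤n+m _ _)

  arcs-⋃ʳ : ∀ {k} (A : Fin n → Bool) (F : Fin k → Fin n → Bool) →
            arcs adj A (λ v → anyFin (λ j → F j v)) ≤ sumFin (λ j → arcs adj A (F j))
  arcs-⋃ʳ A F = begin
    arcs adj A (λ v → anyFin (λ j → F j v)) ≤⟨ arcs-swap A _ ⟩
    arcs adj (λ v → anyFin (λ j → F j v)) A ≤⟨ arcs-⋃ˡ F A ⟩
    sumFin (λ j → arcs adj (F j) A)         ≤⟨ sum-mono (λ j → arcs-swap (F j) A) ⟩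
    sumFin (λ j → arcs adj A (F j))         ∎
    where open ≤-Reasoning

module _ {n : ℕ} (adj : Adj n) where

  arcs-emptyˡ : {A : Fin n → Bool} (B : Fin n → Bool) → (∀ u → A u ≡ false) → arcs adj A B ≡ 0
  arcs-emptyˡ B h = sum-zero (λ u → count-empty (λ v → cong (λ a → a ∧ B v ∧ adj u v) (h u)))

  arcs-emptyʳ : (A : Fin n → Bool) {B : Fin n → Bool} → (∀ v → B v ≡ false) → arcs adj A B ≡ 0
  arcs-emptyʳ A h = sum-zero (λ u → count-empty (λ v →
    trans (cong (λ b → A u ∧ b ∧ adj u v) (h v)) (∧-zeroʳ (A u))))

  row≡deg : (A B : Fin n → Bool) {u : Fin n} → A u ≡ true →
            count (λ v → A u ∧ B v ∧ adj u v) ≡ deg adj B u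
  row≡deg A B {u} Au = count-cong (λ v → cong (λ a → a ∧ B v ∧ adj u v) Au)

  row≡0 : (A B : Fin n → Bool) {u : Fin n} → A u ≡ false →
          count (λ v → A u ∧ B v ∧ adj u v) ≡ 0
  row≡0 A B {u} Au = count-empty (λ v → cong (λ a → a ∧ B v ∧ adj u v) Au)

  arcs-≤-rows : (A B : Fin n → Bool) (c : ℕ) → (∀ u → A u ≡ true → deg adj B u ≤ c) → arcs adj A B ≤ count A * c
  arcs-≤-rows A B c h = sum-≤-count* A c (λ u →
    ≤-bit* c (λ Au → ≤-trans (≤-reflexive (row≡deg A B Au)) (h u Au)) (row≡0 A B))

  arcs-≤-rows-deficit : (A B D : Fin n → Bool) (c : ℕ) → (∀ u → D u ≡ true → A u ≡ true) →
                        (∀ u → A u ≡ true → deg adj B u + bit (D u) ≤ c) → arcs adj A B + count D ≤ count A * c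
  arcs-≤-rows-deficit A B D c D⊆A h = begin
    arcs adj A B + count D                                         ≡⟨ cong (arcs adj A B +_) (count≡sum D) ⟩
    arcs adj A B + sumFin (λ u → bit (D u))                        ≡⟨ sum-+ _ (λ u → bit (D u)) ⟨
    sumFin (λ u → count (λ v → A u ∧ B v ∧ adj u v) + bit (D u))  ≤⟨ sum-≤-count* A c row ⟩
    count A * c                                                    ∎
    where
    open ≤-Reasoning
    ¬D : ∀ u → A u ≡ false → D u ≡ false
    ¬D u Au = ¬-not (λ Du → true≢false (trans (sym (D⊆A u Du)) Au))
    row : ∀ u → count (λ v → A u ∧ B v ∧ adj u v) + bit (D u) ≤ bit (A u) * c
    row u = ≤-bit* c (λ Au → ≤-trans (≤-reflexive (cong (_+ bit (D u)) (row≡deg A B Au))) (h u Au))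
                     (λ Au → cong₂ _+_ (row≡0 A B Au) (cong bit (¬D u Au)))

  deg-≤-count : (B : Fin n → Bool) (u : Fin n) → deg adj B u ≤ count B
  deg-≤-count B u = count-mono (λ v → ∧-fst (B v))

  deg-<-count : (B : Fin n → Bool) {u b : Fin n} → B b ≡ true → adj u b ≡ false → deg adj B u + 1 ≤ count B
  deg-<-count B {u} {b} Bb ub =
    ≤-trans (≤-reflexive (cong (deg adj B u +_) (sym (count-singleton b))))
            (count-disjoint not-b (λ v → ∧-fst (B v)) b∈)
    where
    not-b : ∀ v → B v ∧ adj u v ≡ true → eqB v b ≡ true → ⊥
    not-b v uv v≡b rewrite eqB⇒≡ v≡b = true≢false (trans (sym (∧-snd (B b) uv)) ub)
    b∈ : ∀ v → eqB v b ≡ true → B v ≡ true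
    b∈ v v≡b rewrite eqB⇒≡ v≡b = Bb

  arcs-deficient-rows : (A B D : Fin n → Bool) (p q : ℕ) → count A ≤ p → count B ≤ q →
                        (∀ u → D u ≡ true → A u ≡ true × ∃[ b ] B b ≡ true × adj u b ≡ false) →
                        arcs adj A B + count D ≤ p * q
  arcs-deficient-rows A B D p q |A|≤p |B|≤q deficient =
    ≤-trans (arcs-≤-rows-deficit A B D q (λ u Du → proj₁ (deficient u Du)) row) (*-monoˡ-≤ q |A|≤p)
    where
    row : ∀ u → A u ≡ true → deg adj B u + bit (D u) ≤ q
    row u Au with D u in Du
    ... | false = ≤-trans (≤-reflexive (+-identityʳ _)) (≤-trans (deg-≤-count B u) |B|≤q)
    ... | true with deficient u Du
    ...   | _ , b , Bb , ub = ≤-trans (deg-<-count B Bb ub) |B|≤q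

  arcs-complete : (A B : Fin n → Bool) (p q : ℕ) → count A ≤ p → count B ≤ q → p * q ≤ arcs adj A B →
                  ∀ {a b} → A a ≡ true → B b ≡ true → adj a b ≡ true
  arcs-complete A B p q |A|≤p |B|≤q full {a} {b} Aa Bb with adj a b in ab
  ... | true  = refl
  ... | false = ⊥-elim (<-irrefl refl (≤-trans (≤-reflexive (+-comm 1 _))
      (≤-trans (+-monoʳ-≤ (arcs adj A B) (≤-reflexive (sym (count-singleton a))))
      (≤-trans (arcs-deficient-rows A B (λ u → eqB u a) p q |A|≤p |B|≤q only-a) full))))
    where
    only-a : ∀ u → eqB u a ≡ true → A u ≡ true × ∃[ b′ ] B b′ ≡ true × adj u b′ ≡ false
    only-a u u≡a rewrite eqB⇒≡ u≡a = Aa , b , Bb , ab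

  arcs-two-deficient : (A B : Fin n → Bool) (p q : ℕ) → count A ≤ p → count B ≤ q → p * q ≤ suc (arcs adj A B) →
                       ∀ {c c′ b b′} → c ≢ c′ → A c ≡ true → A c′ ≡ true → B b ≡ true → B b′ ≡ true →
                       adj c b ≡ false → adj c′ b′ ≡ false → ⊥
  arcs-two-deficient A B p q |A|≤p |B|≤q almost-full {c} {c′} {b} {b′} c≢c′ Ac Ac′ Bb Bb′ cb c′b′ =
    <-irrefl refl (≤-trans (≤-reflexive (+-comm 2 (arcs adj A B))) (≤-trans (+-monoʳ-≤ (arcs adj A B) two≤D)
                  (≤-trans (arcs-deficient-rows A B D p q |A|≤p |B|≤q deficient) almost-full)))
    where
    D : Fin n → Bool
    D u = eqB u c ∨ eqB u c′
    two≤D : 2 ≤ count D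
    two≤D = count-≥2 {f = D} c≢c′ (∨-introˡ (eqB-refl c)) (∨-introʳ (eqB c′ c) (eqB-refl c′))
    deficient : ∀ u → D u ≡ true → A u ≡ true × ∃[ b″ ] B b″ ≡ true × adj u b″ ≡ false
    deficient u Du with eqB u c in u≡c
    ... | true  rewrite eqB⇒≡ u≡c = Ac , b , Bb , cb
    ... | false rewrite eqB⇒≡ Du = Ac′ , b′ , Bb′ , c′b′

module _ {n : ℕ} where

  inTri-cases : ∀ {x y z v : Fin n} → inTri (x , y , z) v ≡ true → v ≡ x ⊎ v ≡ y ⊎ v ≡ z
  inTri-cases {x} {y} {z} {v} h with eqB v x in v≡x | eqB v y in v≡y
  ... | true  | _     = inj₁ (eqB⇒≡ v≡x)
  ... | false | true  = inj₂ (inj₁ (eqB⇒≡ v≡y))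
  ... | false | false = inj₂ (inj₂ (eqB⇒≡ h))

  inEdge-cases : ∀ {a b v : Fin n} → inEdge (a , b) v ≡ true → v ≡ a ⊎ v ≡ b
  inEdge-cases {a} {b} {v} h with eqB v a in v≡a
  ... | true  = inj₁ (eqB⇒≡ v≡a)
  ... | false = inj₂ (eqB⇒≡ h)

  ∈-tri₁ : ∀ (x y z : Fin n) → inTri (x , y , z) x ≡ true
  ∈-tri₁ x y z = cong (_∨ (eqB x y ∨ eqB x z)) (eqB-refl x)

  ∈-tri₂ : ∀ (x y z : Fin n) → inTri (x , y , z) y ≡ true
  ∈-tri₂ x y z = trans (cong (λ b → eqB y x ∨ b ∨ eqB y z) (eqB-refl y)) (∨-zeroʳ _)

  ∈-tri₃ : ∀ (x y z : Fin n) → inTri (x , y , z) z ≡ true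
  ∈-tri₃ x y z = trans (cong (λ b → eqB z x ∨ eqB z y ∨ b) (eqB-refl z))
                       (trans (cong (eqB z x ∨_) (∨-zeroʳ _)) (∨-zeroʳ _))

  ∈-edge₁ : ∀ (a b : Fin n) → inEdge (a , b) a ≡ true
  ∈-edge₁ a b = cong (_∨ eqB a b) (eqB-refl a)

  ∈-edge₂ : ∀ (a b : Fin n) → inEdge (a , b) b ≡ true
  ∈-edge₂ a b = trans (cong (eqB b a ∨_) (eqB-refl b)) (∨-zeroʳ _)

  ∉-tri : ∀ {x y z v : Fin n} → v ≢ x → v ≢ y → v ≢ z → inTri (x , y , z) v ≡ false
  ∉-tri v≢x v≢y v≢z rewrite ≢⇒eqB-false v≢x | ≢⇒eqB-false v≢y | ≢⇒eqB-false v≢z = refl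

  count-inTri : (t : Tri n) → count (inTri t) ≤ 3
  count-inTri (x , y , z) = begin
    count (inTri (x , y , z))                                ≤⟨ count-∨ (λ v → eqB v x) _ ⟩
    count (λ v → eqB v x) + count (λ v → eqB v y ∨ eqB v z)  ≤⟨ +-monoʳ-≤ _ (count-∨ (λ v → eqB v y) _) ⟩
    count (λ v → eqB v x) + (count (λ v → eqB v y) + count (λ v → eqB v z))
      ≡⟨ cong₂ _+_ (count-singleton x) (cong₂ _+_ (count-singleton y) (count-singleton z)) ⟩
    3                                                        ∎
    where open ≤-Reasoning

  count-inEdge : (e : Edge n) → count (inEdge e) ≤ 2
  count-inEdge (a , b) = ≤-trans (count-∨ (λ v → eqB v a) _)
                                 (≤-reflexive (cong₂ _+_ (count-singleton a) (count-singleton b)))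

  covTris-empty : ∀ {k} (T : Fin k → Tri n) {P : Fin k → Bool} → (∀ i → P i ≡ false) →
                  ∀ v → covTris T P v ≡ false
  covTris-empty T P∅ v = anyFin-none (λ i → cong (_∧ inTri (T i) v) (P∅ i))

  module _ (adj : Adj n) where

    triangle-edges : ∀ {x y z} → IsTriangle adj (x , y , z) → adj x y ≡ true × adj y z ≡ true × adj x z ≡ true
    triangle-edges {x} {y} {z} t =
      ∧-fst (adj x y) t , ∧-fst (adj y z) (∧-snd (adj x y) t) , ∧-snd (adj y z) (∧-snd (adj x y) t)

    is-tri : ∀ {a b c} → adj a b ≡ true → adj b c ≡ true → adj a c ≡ true → isTriB adj a b c ≡ true
    is-tri ab bc ac = ∧-intro ab (∧-intro bc ac)

    sees-of-two-neighbours : ∀ {x y z u p q} → IsTriangle adj (x , y , z) →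
      inTri (x , y , z) p ≡ true → inTri (x , y , z) q ≡ true → p ≢ q → adj u p ≡ true → adj u q ≡ true →
      vertexSeesTri adj u (x , y , z) ≡ true
    sees-of-two-neighbours {x} {y} {z} {u} {p} {q} t p∈ q∈ p≢q up uq
      with triangle-edges t | inTri-cases {x} {y} {z} {p} p∈ | inTri-cases {x} {y} {z} {q} q∈
    ... | xy , _  , _  | inj₁ refl        | inj₂ (inj₁ refl) = ∨-introˡ (is-tri up xy uq)
    ... | xy , _  , _  | inj₂ (inj₁ refl) | inj₁ refl        = ∨-introˡ (is-tri uq xy up)
    ... | _  , yz , _  | inj₂ (inj₁ refl) | inj₂ (inj₂ refl) = ∨-intro₂ (isTriB adj u x y) (is-tri up yz uq)
    ... | _  , yz , _  | inj₂ (inj₂ refl) | inj₂ (inj₁ refl) = ∨-intro₂ (isTriB adj u x y) (is-tri uq yz up)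
    ... | _  , _  , xz | inj₁ refl        | inj₂ (inj₂ refl) =
      ∨-intro₃ (isTriB adj u x y) (isTriB adj u y z) (is-tri up xz uq)
    ... | _  , _  , xz | inj₂ (inj₂ refl) | inj₁ refl        =
      ∨-intro₃ (isTriB adj u x y) (isTriB adj u y z) (is-tri uq xz up)
    ... | _            | inj₁ refl        | inj₁ refl        = ⊥-elim (p≢q refl)
    ... | _            | inj₂ (inj₁ refl) | inj₂ (inj₁ refl) = ⊥-elim (p≢q refl)
    ... | _            | inj₂ (inj₂ refl) | inj₂ (inj₂ refl) = ⊥-elim (p≢q refl)

    sees-of-common-neighbour : ∀ {a b x y z c} → adj a b ≡ true → inTri (x , y , z) c ≡ true →
      adj a c ≡ true → adj b c ≡ true → edgeSeesTri adj (a , b) (x , y , z) ≡ true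
    sees-of-common-neighbour {a} {b} {x} {y} {z} {c} ab c∈ ac bc with inTri-cases {x} {y} {z} {c} c∈
    ... | inj₁ refl        = ∨-introˡ (is-tri ab bc ac)
    ... | inj₂ (inj₁ refl) = ∨-intro₂ (isTriB adj a b x) (is-tri ab bc ac)
    ... | inj₂ (inj₂ refl) = ∨-intro₃ (isTriB adj a b x) (isTriB adj a b y) (is-tri ab bc ac)

    deg-unseen-triangle : ∀ {u} (t : Tri n) → IsTriangle adj t → vertexSeesTri adj u t ≡ false →
                          deg adj (inTri t) u ≤ 1
    deg-unseen-triangle {u} (x , y , z) t unseen = count-≤1 unique
      where
      unique : ∀ p q → inTri (x , y , z) p ∧ adj u p ≡ true → inTri (x , y , z) q ∧ adj u q ≡ true → p ≡ q
      unique p q hp hq with p ≟ q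
      ... | yes p≡q = p≡q
      ... | no p≢q  = ⊥-elim (true≢false (trans (sym (sees-of-two-neighbours t (∧-fst _ hp) (∧-fst _ hq) p≢q
                                                         (∧-snd _ hp) (∧-snd _ hq))) unseen))

    vertex-to-triangle : ∀ {u} (t : Tri n) → IsTriangle adj t →
                         deg adj (inTri t) u ≤ 1 + bit (vertexSeesTri adj u t) * 2
    vertex-to-triangle {u} t t-tri with vertexSeesTri adj u t in sees
    ... | true  = ≤-trans (deg-≤-count adj (inTri t) u) (count-inTri t)
    ... | false = ≤-trans (deg-unseen-triangle t t-tri sees) (s≤s z≤n)

    edge-to-triangle : Symmetric adj → ∀ {a b} (t : Tri n) → adj a b ≡ true →
                       arcs adj (inEdge (a , b)) (inTri t) ≤ 3 + bit (edgeSeesTri adj (a , b) t) * 3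
    edge-to-triangle adj-sym {a} {b} t ab with edgeSeesTri adj (a , b) t in sees
    ... | true  = ≤-trans (arcs-≤-rows adj (inEdge (a , b)) (inTri t) 3
                            (λ u _ → ≤-trans (deg-≤-count adj (inTri t) u) (count-inTri t)))
                          (*-monoˡ-≤ 3 (count-inEdge (a , b)))
    ... | false = ≤-trans (arcs-swap adj-sym (inEdge (a , b)) (inTri t))
                  (≤-trans (arcs-≤-rows adj (inTri t) (inEdge (a , b)) 1 (λ c c∈ → deg-unseen-edge c c∈))
                           (≤-trans (*-monoˡ-≤ 1 (count-inTri t)) (≤-reflexive (+-identityʳ 3))))
      where
      deg-unseen-edge : ∀ c → inTri t c ≡ true → deg adj (inEdge (a , b)) c ≤ 1
      deg-unseen-edge c c∈ = count-≤1 unique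
        where
        common : adj c a ≡ true → adj c b ≡ true → ⊥
        common ca cb = true≢false (trans (sym (sees-of-common-neighbour ab c∈
                         (trans (adj-sym a c) ca) (trans (adj-sym b c) cb))) sees)
        unique : ∀ v w → inEdge (a , b) v ∧ adj c v ≡ true → inEdge (a , b) w ∧ adj c w ≡ true → v ≡ w
        unique v w hv hw with inEdge-cases {a} {b} {v} (∧-fst _ hv) | inEdge-cases {a} {b} {w} (∧-fst _ hw)
        ... | inj₁ refl | inj₁ refl = refl
        ... | inj₂ refl | inj₂ refl = refl
        ... | inj₁ refl | inj₂ refl = ⊥-elim (common (∧-snd _ hv) (∧-snd _ hw))
        ... | inj₂ refl | inj₁ refl = ⊥-elim (common (∧-snd _ hw) (∧-snd _ hv))

    arcs-full : (s t : Tri n) → 9 ≤ arcs adj (inTri s) (inTri t) →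
                ∀ {a b} → inTri s a ≡ true → inTri t b ≡ true → adj a b ≡ true
    arcs-full s t = arcs-complete adj (inTri s) (inTri t) 3 3 (count-inTri s) (count-inTri t)

    arcs-triangles-≤9 : (s t : Tri n) → arcs adj (inTri s) (inTri t) ≤ 9
    arcs-triangles-≤9 s t = ≤-trans (arcs-≤-rows adj (inTri s) (inTri t) 3
                                      (λ u _ → ≤-trans (deg-≤-count adj (inTri t) u) (count-inTri t)))
                                    (*-monoˡ-≤ 3 (count-inTri s))

    adjacent-to-both : ∀ {B : Fin n → Bool} {q r} c → B q ≡ true → B r ≡ true →
                       (adj c q ≡ true × adj c r ≡ true) ⊎ (∃[ b ] B b ≡ true × adj c b ≡ false)
    adjacent-to-both {q = q} {r} c q∈ r∈ with adj c q in cq | adj c r in cr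
    ... | true  | true  = inj₁ (refl , refl)
    ... | false | _     = inj₂ (q , q∈ , cq)
    ... | true  | false = inj₂ (r , r∈ , cr)

    -- with 8 of the 9 possible edges present, at most one vertex of t misses a vertex of s
    arcs-heavy : Symmetric adj → (s t : Tri n) → 8 ≤ arcs adj (inTri s) (inTri t) →
                 ∀ {q r c c′} → inTri s q ≡ true → inTri s r ≡ true → inTri t c ≡ true → inTri t c′ ≡ true →
                 c ≢ c′ → (adj c q ≡ true × adj c r ≡ true) ⊎ (adj c′ q ≡ true × adj c′ r ≡ true)
    arcs-heavy adj-sym s t heavy {c = c} {c′} q∈ r∈ c∈ c′∈ c≢c′
      with adjacent-to-both c q∈ r∈ | adjacent-to-both c′ q∈ r∈
    ... | inj₁ c-both | _           = inj₁ c-both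
    ... | inj₂ _      | inj₁ c′-both = inj₂ c′-both
    ... | inj₂ (b , b∈ , cb) | inj₂ (b′ , b′∈ , c′b′) =
      ⊥-elim (arcs-two-deficient adj (inTri t) (inTri s) 3 3 (count-inTri t) (count-inTri s)
               (s≤s (≤-trans heavy (arcs-swap adj-sym (inTri s) (inTri t))))
               c≢c′ c∈ c′∈ b∈ b′∈ cb c′b′)

edges-to-family : ∀ {n k} {adj : Adj n} → Symmetric adj →
                  (A B : Fin n → Bool) (T : Fin k → Tri n) (Q : Fin k → Bool) (c : ℕ) →
                  (∀ j → Q j ≡ true → arcs adj A (inTri (T j)) + arcs adj B (inTri (T j)) ≤ c) →
                  e adj A (covTris T Q) + e adj B (covTris T Q) ≤ count Q * c
edges-to-family {n} {k} {adj} adj-sym A B T Q c per-triangle = begin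
  e adj A (covTris T Q) + e adj B (covTris T Q)
    ≤⟨ +-mono-≤ (e-≤-arcs adj-sym A _) (e-≤-arcs adj-sym B _) ⟩
  arcs adj A (covTris T Q) + arcs adj B (covTris T Q)
    ≤⟨ +-mono-≤ (arcs-⋃ʳ adj-sym A F) (arcs-⋃ʳ adj-sym B F) ⟩
  sumFin (λ j → arcs adj A (F j)) + sumFin (λ j → arcs adj B (F j))
    ≡⟨ sum-+ (λ j → arcs adj A (F j)) (λ j → arcs adj B (F j)) ⟨
  sumFin (λ j → arcs adj A (F j) + arcs adj B (F j))
    ≤⟨ sum-≤-count* Q c per-index ⟩
  count Q * c ∎
  where
  open ≤-Reasoning
  F : Fin k → Fin n → Bool
  F j v = Q j ∧ inTri (T j) v
  per-index : ∀ j → arcs adj A (F j) + arcs adj B (F j) ≤ bit (Q j) * c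
  per-index j with Q j in Qj
  ... | true  = ≤-trans (per-triangle j Qj) (≤-reflexive (sym (+-identityʳ c)))
  ... | false = ≤-reflexive (cong₂ _+_ (arcs-emptyʳ adj A (λ _ → refl)) (arcs-emptyʳ adj B (λ _ → refl)))

module _ {n k} (adj : Adj n) (T : Fin k → Tri n) (P : Fin k → Bool) (B : Fin n → Bool) where

  from-family : ℕ
  from-family = sumFin λ i → arcs adj (λ u → P i ∧ inTri (T i) u) B

  from-family-cover : Symmetric adj → arcs adj (covTris T P) B ≤ from-family
  from-family-cover adj-sym = arcs-⋃ˡ adj-sym (λ i u → P i ∧ inTri (T i) u) B

  from-family-≤ : ∀ c → (∀ i → P i ≡ true → arcs adj (inTri (T i)) B ≤ c) → from-family ≤ count P * c
  from-family-≤ c bound = sum-≤-count* P c λ i →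
    ≤-bit* c (λ Pi → subst (λ b → arcs adj (λ u → b ∧ inTri (T i) u) B ≤ c) (sym Pi) (bound i Pi))
             (λ Pi → arcs-emptyˡ adj B (λ u → cong (_∧ inTri (T i) u) Pi))

  from-family-≤-except : ∀ c d i₀ → (∀ i → P i ≡ true → i ≢ i₀ → arcs adj (inTri (T i)) B ≤ c) →
                         arcs adj (inTri (T i₀)) B ≤ c + d → from-family ≤ count P * c + d
  from-family-≤-except c d i₀ bound bound₀ =
    ≤-trans (sum-≤-counts P (λ i → eqB i i₀) c d term)
            (≤-reflexive (cong (count P * c +_) (trans (cong (_* d) (count-singleton i₀)) (*-identityˡ d))))
    where
    term : ∀ i → arcs adj (λ u → P i ∧ inTri (T i) u) B ≤ bit (P i) * c + bit (eqB i i₀) * d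
    term i with P i in Pi | eqB i i₀ in i≡i₀
    ... | false | _     = ≤-trans (≤-reflexive (arcs-emptyˡ adj B (λ _ → refl))) z≤n
    ... | true  | true  rewrite eqB⇒≡ i≡i₀ =
      ≤-trans bound₀ (≤-reflexive (sym (cong₂ _+_ (+-identityʳ c) (+-identityʳ d))))
    ... | true  | false = ≤-trans (bound i Pi (eqB-false⇒≢ i≡i₀))
                                  (≤-reflexive (sym (trans (+-identityʳ _) (+-identityʳ c))))

-- Exchanging triangles of a disjoint family

record Disjoint {n} (t t′ : Tri n) : Set where
  constructor apart
  field disjoint : ∀ v → inTri t v ≡ true → inTri t′ v ≡ false
open Disjoint

module _ {n : ℕ} where

  disjoint-sym : {t t′ : Tri n} → Disjoint t t′ → Disjoint t′ t
  disjoint-sym {t} d = apart λ v v∈t′ → flip v v∈t′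
    where
    flip : ∀ v → inTri _ v ≡ true → inTri t v ≡ false
    flip v v∈t′ with inTri t v in v∈t
    ... | false = refl
    ... | true  = ⊥-elim (true≢false (trans (sym v∈t′) (disjoint d v v∈t)))

  disjoint-by-vertices : ∀ {a b c} (t : Tri n) → inTri t a ≡ false → inTri t b ≡ false → inTri t c ≡ false →
                         Disjoint (a , b , c) t
  disjoint-by-vertices {a} {b} {c} t a∉ b∉ c∉ = apart by-cases
    where
    by-cases : ∀ v → inTri (a , b , c) v ≡ true → inTri t v ≡ false
    by-cases v v∈ with inTri-cases {x = a} {b} {c} {v} v∈
    ... | inj₁ refl        = a∉
    ... | inj₂ (inj₁ refl) = b∉
    ... | inj₂ (inj₂ refl) = c∉

  replace : ∀ {k} → (Fin k → Tri n) → Fin k → Tri n → Fin k → Tri n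
  replace F j t i = if eqB i j then t else F i

  extend : ∀ {k} → Tri n → (Fin k → Tri n) → Fin (suc k) → Tri n
  extend t F fzero    = t
  extend t F (fsuc i) = F i

  replace-elim : ∀ {k} (P : Tri n → Set) (F : Fin k → Tri n) j t i →
                 (i ≡ j → P t) → (i ≢ j → P (F i)) → P (replace F j t i)
  replace-elim P F j t i new old with eqB i j in i≡j
  ... | true  = new (eqB⇒≡ i≡j)
  ... | false = old (eqB-false⇒≢ i≡j)

  replaced₂-avoids : ∀ {k} (F : Fin k → Tri n) j₁ j₂ t₁ t₂ v → inTri t₁ v ≡ false → inTri t₂ v ≡ false →
                     (∀ i → i ≢ j₁ → i ≢ j₂ → inTri (F i) v ≡ false) →
                     ∀ i → inTri (replace (replace F j₁ t₁) j₂ t₂ i) v ≡ false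
  replaced₂-avoids F j₁ j₂ t₁ t₂ v v∉t₁ v∉t₂ v∉F i =
    replace-elim (λ s → inTri s v ≡ false) (replace F j₁ t₁) j₂ t₂ i (λ _ → v∉t₂) λ i≢j₂ →
    replace-elim (λ s → inTri s v ≡ false) F j₁ t₁ i (λ _ → v∉t₁) λ i≢j₁ → v∉F i i≢j₁ i≢j₂

  replaced₃-avoids : ∀ {k} (F : Fin k → Tri n) j₁ j₂ j₃ t₁ t₂ t₃ v →
                     inTri t₁ v ≡ false → inTri t₂ v ≡ false → inTri t₃ v ≡ false →
                     (∀ i → i ≢ j₁ → i ≢ j₂ → i ≢ j₃ → inTri (F i) v ≡ false) →
                     ∀ i → inTri (replace (replace (replace F j₁ t₁) j₂ t₂) j₃ t₃ i) v ≡ false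
  replaced₃-avoids F j₁ j₂ j₃ t₁ t₂ t₃ v v∉t₁ v∉t₂ v∉t₃ v∉F i =
    replace-elim (λ s → inTri s v ≡ false) (replace (replace F j₁ t₁) j₂ t₂) j₃ t₃ i (λ _ → v∉t₃) λ i≢j₃ →
    replace-elim (λ s → inTri s v ≡ false) (replace F j₁ t₁) j₂ t₂ i (λ _ → v∉t₂) λ i≢j₂ →
    replace-elim (λ s → inTri s v ≡ false) F j₁ t₁ i (λ _ → v∉t₁) λ i≢j₁ → v∉F i i≢j₁ i≢j₂ i≢j₃

  module _ (adj : Adj n) where

    replace-disjoint : ∀ {k} {F : Fin k → Tri n} {j t} → IsDisjointTriangles adj F → IsTriangle adj t →
                       (∀ i → i ≢ j → Disjoint t (F i)) → IsDisjointTriangles adj (replace F j t)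
    replace-disjoint {F = F} {j} {t} (F-tri , F-disj) t-tri t-new =
      (λ i → replace-elim (IsTriangle adj) F j t i (λ _ → t-tri) (λ _ → F-tri i)) ,
      λ i i′ i≢i′ → disjoint (replace-elim (λ s → Disjoint s (replace F j t i′)) F j t i
        (λ i≡j → replace-elim (Disjoint t) F j t i′ (λ i′≡j → ⊥-elim (i≢i′ (trans i≡j (sym i′≡j)))) (t-new i′))
        (λ i≢j → replace-elim (Disjoint (F i)) F j t i′ (λ _ → disjoint-sym (t-new i i≢j))
                                                         (λ _ → apart (F-disj i i′ i≢i′))))

    extend-disjoint : ∀ {k} {F : Fin k → Tri n} {t} → IsDisjointTriangles adj F → IsTriangle adj t →
                      (∀ i → Disjoint t (F i)) → IsDisjointTriangles adj (extend t F)
    extend-disjoint {F = F} {t} (F-tri , F-disj) t-tri t-new = tri , λ i i′ i≢i′ → disjoint (disj i i′ i≢i′)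
      where
      tri : ∀ i → IsTriangle adj (extend t F i)
      tri fzero    = t-tri
      tri (fsuc i) = F-tri i
      disj : ∀ i i′ → i ≢ i′ → Disjoint (extend t F i) (extend t F i′)
      disj fzero    fzero     i≢i′ = ⊥-elim (i≢i′ refl)
      disj fzero    (fsuc i′) _    = t-new i′
      disj (fsuc i) fzero     _    = disjoint-sym (t-new i)
      disj (fsuc i) (fsuc i′) i≢i′ = apart (F-disj i i′ (i≢i′ ∘ cong fsuc))

    replaced₂-disjoint : ∀ {k} {F : Fin k → Tri n} → IsDisjointTriangles adj F → ∀ {j₁ j₂ t₁ t₂} →
                         IsTriangle adj t₁ → IsTriangle adj t₂ → Disjoint t₂ t₁ →
                         (∀ i → i ≢ j₁ → Disjoint t₁ (F i)) → (∀ i → i ≢ j₁ → i ≢ j₂ → Disjoint t₂ (F i)) →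
                         IsDisjointTriangles adj (replace (replace F j₁ t₁) j₂ t₂)
    replaced₂-disjoint {F = F} F-disj {j₁} {j₂} {t₁} {t₂} t₁-tri t₂-tri d₂₁ new₁ new₂ =
      replace-disjoint (replace-disjoint F-disj t₁-tri new₁) t₂-tri
        (λ i i≢j₂ → replace-elim (Disjoint t₂) F j₁ t₁ i (λ _ → d₂₁) (λ i≢j₁ → new₂ i i≢j₁ i≢j₂))

    replaced₃-disjoint : ∀ {k} {F : Fin k → Tri n} → IsDisjointTriangles adj F → ∀ {j₁ j₂ j₃ t₁ t₂ t₃} →
                         IsTriangle adj t₁ → IsTriangle adj t₂ → IsTriangle adj t₃ →
                         Disjoint t₂ t₁ → Disjoint t₃ t₁ → Disjoint t₃ t₂ →
                         (∀ i → i ≢ j₁ → Disjoint t₁ (F i)) → (∀ i → i ≢ j₁ → i ≢ j₂ → Disjoint t₂ (F i)) →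
                         (∀ i → i ≢ j₁ → i ≢ j₂ → i ≢ j₃ → Disjoint t₃ (F i)) →
                         IsDisjointTriangles adj (replace (replace (replace F j₁ t₁) j₂ t₂) j₃ t₃)
    replaced₃-disjoint {F = F} F-disj {j₁} {j₂} {j₃} {t₁} {t₂} {t₃}
                       t₁-tri t₂-tri t₃-tri d₂₁ d₃₁ d₃₂ new₁ new₂ new₃ =
      replace-disjoint (replaced₂-disjoint F-disj t₁-tri t₂-tri d₂₁ new₁ new₂) t₃-tri
        (λ i i≢j₃ → replace-elim (Disjoint t₃) (replace F j₁ t₁) j₂ t₂ i (λ _ → d₃₂) λ i≢j₂ →
                    replace-elim (Disjoint t₃) F j₁ t₁ i (λ _ → d₃₁) λ i≢j₁ → new₃ i i≢j₁ i≢j₂ i≢j₃)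

    exchange₁₂ : ∀ {k} {F : Fin k → Tri n} → IsDisjointTriangles adj F → ∀ {j t₁ t₂} →
                 IsTriangle adj t₁ → IsTriangle adj t₂ → Disjoint t₁ t₂ →
                 (∀ i → i ≢ j → Disjoint t₁ (F i)) → (∀ i → i ≢ j → Disjoint t₂ (F i)) →
                 HasDisjointTriangles adj (suc k)
    exchange₁₂ {F = F} F-disj {j} {t₁} {t₂} t₁-tri t₂-tri d₁₂ new₁ new₂ =
      extend t₁ (replace F j t₂) ,
      extend-disjoint (replace-disjoint F-disj t₂-tri new₂) t₁-tri
        (λ i → replace-elim (Disjoint t₁) F j t₂ i (λ _ → d₁₂) (new₁ i))

    exchange₂₃ : ∀ {k} {F : Fin k → Tri n} → IsDisjointTriangles adj F → ∀ {j₁ j₂ t₁ t₂ t₃} →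
                 IsTriangle adj t₁ → IsTriangle adj t₂ → IsTriangle adj t₃ →
                 Disjoint t₂ t₁ → Disjoint t₃ t₁ → Disjoint t₂ t₃ →
                 (∀ i → i ≢ j₁ → Disjoint t₁ (F i)) →
                 (∀ i → i ≢ j₁ → i ≢ j₂ → Disjoint t₂ (F i)) →
                 (∀ i → i ≢ j₁ → i ≢ j₂ → Disjoint t₃ (F i)) → HasDisjointTriangles adj (suc k)
    exchange₂₃ {F = F} F-disj {j₁} {j₂} {t₁} {t₂} {t₃} t₁-tri t₂-tri t₃-tri d₂₁ d₃₁ d₂₃ new₁ new₂ new₃ =
      exchange₁₂ (replace-disjoint F-disj t₁-tri new₁) {j₂} t₂-tri t₃-tri d₂₃
        (λ i i≢j₂ → replace-elim (Disjoint t₂) F j₁ t₁ i (λ _ → d₂₁) (λ i≢j₁ → new₂ i i≢j₁ i≢j₂))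
        (λ i i≢j₂ → replace-elim (Disjoint t₃) F j₁ t₁ i (λ _ → d₃₁) (λ i≢j₁ → new₃ i i≢j₁ i≢j₂))

    exchange₃₄ : ∀ {k} {F : Fin k → Tri n} → IsDisjointTriangles adj F → ∀ {j₁ j₂ j₃ t₁ t₂ t₃ t₄} →
                 IsTriangle adj t₁ → IsTriangle adj t₂ → IsTriangle adj t₃ → IsTriangle adj t₄ →
                 Disjoint t₂ t₁ → Disjoint t₃ t₁ → Disjoint t₄ t₁ →
                 Disjoint t₃ t₂ → Disjoint t₄ t₂ → Disjoint t₃ t₄ →
                 (∀ i → i ≢ j₁ → Disjoint t₁ (F i)) →
                 (∀ i → i ≢ j₁ → i ≢ j₂ → Disjoint t₂ (F i)) →
                 (∀ i → i ≢ j₁ → i ≢ j₂ → i ≢ j₃ → Disjoint t₃ (F i)) →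
                 (∀ i → i ≢ j₁ → i ≢ j₂ → i ≢ j₃ → Disjoint t₄ (F i)) → HasDisjointTriangles adj (suc k)
    exchange₃₄ {F = F} F-disj {j₁} {j₂} {j₃} {t₁} {t₂} {t₃} {t₄}
               t₁-tri t₂-tri t₃-tri t₄-tri d₂₁ d₃₁ d₄₁ d₃₂ d₄₂ d₃₄ new₁ new₂ new₃ new₄ =
      exchange₂₃ (replace-disjoint F-disj t₁-tri new₁) {j₂} {j₃} t₂-tri t₃-tri t₄-tri d₃₂ d₄₂ d₃₄
        (λ i i≢j₂ → replace-elim (Disjoint t₂) F j₁ t₁ i (λ _ → d₂₁) (λ i≢j₁ → new₂ i i≢j₁ i≢j₂))
        (λ i i≢j₂ i≢j₃ → replace-elim (Disjoint t₃) F j₁ t₁ i (λ _ → d₃₁) (λ i≢j₁ → new₃ i i≢j₁ i≢j₂ i≢j₃))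
        (λ i i≢j₂ i≢j₃ → replace-elim (Disjoint t₄) F j₁ t₁ i (λ _ → d₄₁) (λ i≢j₁ → new₄ i i≢j₁ i≢j₂ i≢j₃))

cons-edge : ∀ {n m} → Edge n → (Fin m → Edge n) → Fin (suc m) → Edge n
cons-edge e M fzero    = e
cons-edge e M (fsuc l) = M l

matching-extend : ∀ {n k m} (adj : Adj n) {F : Fin k → Tri n} {M : Fin m → Edge n} {z w} →
                  IsMatchingAvoiding adj F M → adj z w ≡ true →
                  (∀ l → inEdge (M l) z ≡ false) → (∀ l → inEdge (M l) w ≡ false) →
                  covTris F (λ _ → true) z ≡ false → covTris F (λ _ → true) w ≡ false →
                  IsMatchingAvoiding adj F (cons-edge (z , w) M)
matching-extend {n} {k} {m} adj {F} {M} {z} {w} (M-adj , M-disj , M-avoid) zw z∉M w∉M z∉F w∉F =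
  adjacent , separate , avoid
  where
  M′ : Fin (suc m) → Edge n
  M′ = cons-edge (z , w) M
  adjacent : ∀ l → adj (proj₁ (M′ l)) (proj₂ (M′ l)) ≡ true
  adjacent fzero    = zw
  adjacent (fsuc l) = M-adj l
  new∉M : ∀ l v → inEdge (z , w) v ≡ true → inEdge (M l) v ≡ false
  new∉M l v v∈ with inEdge-cases {a = z} {w} {v} v∈
  ... | inj₁ refl = z∉M l
  ... | inj₂ refl = w∉M l
  separate : ∀ l l′ → l ≢ l′ → ∀ v → inEdge (M′ l) v ≡ true → inEdge (M′ l′) v ≡ false
  separate fzero    fzero     l≢l′ = ⊥-elim (l≢l′ refl)
  separate fzero    (fsuc l′) _    = new∉M l′
  separate (fsuc l) fzero     _    v v∈ with inEdge (z , w) v in v∈new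
  ... | false = refl
  ... | true  = ⊥-elim (true≢false (trans (sym v∈) (new∉M l v v∈new)))
  separate (fsuc l) (fsuc l′) l≢l′ = M-disj l l′ (l≢l′ ∘ cong fsuc)
  avoid : ∀ l v → inEdge (M′ l) v ≡ true → covTris F (λ _ → true) v ≡ false
  avoid fzero    v v∈ with inEdge-cases {a = z} {w} {v} v∈
  ... | inj₁ refl = z∉F
  ... | inj₂ refl = w∉F
  avoid (fsuc l) = M-avoid l

module Setting {n k m} (adj : Adj n) (simple : IsSimpleGraph adj)
  (T : Fin k → Tri n) (T-disjoint : IsDisjointTriangles adj T)
  (M : Fin m → Edge n) (M-matching : IsMatchingAvoiding adj T M)
  (no-k+1 : ¬ HasDisjointTriangles adj (suc k)) (T-optimal : TChoiceOptimal adj T m) where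

  adj-sym : Symmetric adj
  adj-sym = proj₁ simple

  adjacent⇒≢ : ∀ {a b} → adj a b ≡ true → a ≢ b
  adjacent⇒≢ {a} ab refl = true≢false (trans (sym ab) (proj₂ simple a))

  I : Fin n → Bool
  I = inI T M

  end₁ end₂ : Fin m → Fin n
  end₁ l = proj₁ (M l)
  end₂ l = proj₂ (M l)

  M-adj : ∀ l → adj (end₁ l) (end₂ l) ≡ true
  M-adj = proj₁ M-matching

  data Part : Set where
    tri       : Fin k → Part
    edge      : Fin m → Part
    uncovered : Part

  data _∈ᴾ_ (v : Fin n) : Part → Set where
    in-tri  : ∀ {i} → inTri (T i) v ≡ true → v ∈ᴾ tri i
    in-edge : ∀ {l} → inEdge (M l) v ≡ true → v ∈ᴾ edge l
    in-I    : I v ≡ true → v ∈ᴾ uncovered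

  ∈tri⇒ : ∀ {v i} → v ∈ᴾ tri i → inTri (T i) v ≡ true
  ∈tri⇒ (in-tri v∈) = v∈

  end₁∈ : ∀ l → end₁ l ∈ᴾ edge l
  end₁∈ l = in-edge (∈-edge₁ (end₁ l) (end₂ l))

  end₂∈ : ∀ l → end₂ l ∈ᴾ edge l
  end₂∈ l = in-edge (∈-edge₂ (end₁ l) (end₂ l))

  private
    unique-index : ∀ {j} {F : Fin j → Fin n → Bool} → (∀ i i′ → i ≢ i′ → ∀ v → F i v ≡ true → F i′ v ≡ false) →
                   ∀ {i i′} v → F i v ≡ true → F i′ v ≡ true → i ≡ i′
    unique-index disj {i} {i′} v v∈ v∈′ with i ≟ i′
    ... | yes i≡i′ = i≡i′
    ... | no i≢i′  = ⊥-elim (true≢false (trans (sym v∈′) (disj i i′ i≢i′ v v∈)))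

    not-in-T : ∀ v → covTris T (λ _ → true) v ≡ false → ∀ i → inTri (T i) v ≡ false
    not-in-T v = anyFin-false (λ i → inTri (T i) v)

  avoids-T : ∀ {v P} → v ∈ᴾ P → ∀ i → P ≢ tri i → inTri (T i) v ≡ false
  avoids-T {v} (in-tri {j} v∈) i j≢i with inTri (T i) v in v∈i
  ... | false = refl
  ... | true  = ⊥-elim (j≢i (cong tri (unique-index (proj₂ T-disjoint) v v∈ v∈i)))
  avoids-T {v} (in-edge {l} v∈) = λ i _ → not-in-T v (proj₂ (proj₂ M-matching) l v v∈) i
  avoids-T {v} (in-I v∈) = λ i _ → not-in-T v (not-true (∧-fst (not (covTris T (λ _ → true) v)) v∈)) i

  I-avoids-M : ∀ v → I v ≡ true → ∀ l → inEdge (M l) v ≡ false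
  I-avoids-M v v∈ = anyFin-false (λ l → inEdge (M l) v) (not-true (∧-snd (not (covTris T (λ _ → true) v)) v∈))

  part-unique : ∀ {v P Q} → v ∈ᴾ P → v ∈ᴾ Q → P ≡ Q
  part-unique {v} (in-tri v∈)  (in-tri v∈′)  = cong tri (unique-index (proj₂ T-disjoint) v v∈ v∈′)
  part-unique {v} (in-edge v∈) (in-edge v∈′) = cong edge (unique-index (proj₁ (proj₂ M-matching)) v v∈ v∈′)
  part-unique     (in-I _)     (in-I _)      = refl
  part-unique     (in-tri {i} v∈)  v∈′@(in-edge _)   = ⊥-elim (true≢false (trans (sym v∈) (avoids-T v∈′ i λ ())))
  part-unique     (in-tri {i} v∈)  v∈′@(in-I _)      = ⊥-elim (true≢false (trans (sym v∈) (avoids-T v∈′ i λ ())))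
  part-unique     v∈@(in-edge _)   (in-tri {i} v∈′)  = ⊥-elim (true≢false (trans (sym v∈′) (avoids-T v∈ i λ ())))
  part-unique     v∈@(in-I _)      (in-tri {i} v∈′)  = ⊥-elim (true≢false (trans (sym v∈′) (avoids-T v∈ i λ ())))
  part-unique {v} (in-edge {l} v∈) (in-I v∈′)        = ⊥-elim (true≢false (trans (sym v∈) (I-avoids-M v v∈′ l)))
  part-unique {v} (in-I v∈)        (in-edge {l} v∈′) = ⊥-elim (true≢false (trans (sym v∈′) (I-avoids-M v v∈ l)))

  distinct : ∀ {a b P Q} → a ∈ᴾ P → b ∈ᴾ Q → P ≢ Q → a ≢ b
  distinct a∈ b∈ P≢Q refl = P≢Q (part-unique a∈ b∈)

  tri≢ : ∀ {i j} → i ≢ j → tri i ≢ tri j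
  tri≢ i≢j refl = i≢j refl

  edge≢ : ∀ {l h} → l ≢ h → edge l ≢ edge h
  edge≢ l≢h refl = l≢h refl

  private
    common : ∀ {a b c} → adj a b ≡ true × adj b c ≡ true × adj a c ≡ true → adj a c ≡ true × adj b c ≡ true
    common (_ , bc , ac) = ac , bc

    outer : ∀ {u a b} → adj u a ≡ true × adj a b ≡ true × adj u b ≡ true → adj u a ≡ true × adj u b ≡ true
    outer (ua , _ , ub) = ua , ub

  record Corners (i : Fin k) (p q r : Fin n) : Set where
    field
      p∈ : p ∈ᴾ tri i
      q∈ : q ∈ᴾ tri i
      r∈ : r ∈ᴾ tri i
      pq : adj p q ≡ true
      qr : adj q r ≡ true
      pr : adj p r ≡ true

    p≢q : p ≢ q
    p≢q = adjacent⇒≢ pq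
    q≢r : q ≢ r
    q≢r = adjacent⇒≢ qr
    p≢r : p ≢ r
    p≢r = adjacent⇒≢ pr

  x₁ x₂ x₃ : Fin k → Fin n
  x₁ i = proj₁ (T i)
  x₂ i = proj₁ (proj₂ (T i))
  x₃ i = proj₂ (proj₂ (T i))

  corners : ∀ i → Corners i (x₁ i) (x₂ i) (x₃ i)
  corners i with triangle-edges adj {x₁ i} {x₂ i} {x₃ i} (proj₁ T-disjoint i)
  ... | xy , yz , xz = record
    { p∈ = in-tri (∈-tri₁ (x₁ i) (x₂ i) (x₃ i)) ; q∈ = in-tri (∈-tri₂ (x₁ i) (x₂ i) (x₃ i))
    ; r∈ = in-tri (∈-tri₃ (x₁ i) (x₂ i) (x₃ i)) ; pq = xy ; qr = yz ; pr = xz }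

  rotate : ∀ {i p q r} → Corners i p q r → Corners i q r p
  rotate c = record
    { p∈ = q∈ ; q∈ = r∈ ; r∈ = p∈ ; pq = qr ; qr = trans (adj-sym _ _) pr ; pr = trans (adj-sym _ _) pq }
    where open Corners c

  swap : ∀ {i p q r} → Corners i p q r → Corners i q p r
  swap c = record { p∈ = q∈ ; q∈ = p∈ ; r∈ = r∈ ; pq = trans (adj-sym _ _) pq ; qr = pr ; pr = qr }
    where open Corners c

  corners-at : ∀ {i v} → v ∈ᴾ tri i → ∃[ d ] ∃[ e ] Corners i v d e
  corners-at {i} {v} (in-tri v∈) with inTri-cases {x = x₁ i} {x₂ i} {x₃ i} {v} v∈
  ... | inj₁ refl        = _ , _ , corners i
  ... | inj₂ (inj₁ refl) = _ , _ , rotate (corners i)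
  ... | inj₂ (inj₂ refl) = _ , _ , rotate (rotate (corners i))

  seen-by-edge : ∀ {l i} → edgeSeesTri adj (M l) (T i) ≡ true →
                 ∃[ p ] ∃[ q ] ∃[ r ] Corners i p q r × adj (end₁ l) p ≡ true × adj (end₂ l) p ≡ true
  seen-by-edge {l} {i} sees
    with isTriB adj (end₁ l) (end₂ l) (x₁ i) in ab₁ | isTriB adj (end₁ l) (end₂ l) (x₂ i) in ab₂
  ... | true  | _     = _ , _ , _ , corners i , common (triangle-edges adj {end₁ l} {end₂ l} {x₁ i} ab₁)
  ... | false | true  = _ , _ , _ , rotate (corners i) , common (triangle-edges adj {end₁ l} {end₂ l} {x₂ i} ab₂)
  ... | false | false = _ , _ , _ , rotate (rotate (corners i)) ,
                        common (triangle-edges adj {end₁ l} {end₂ l} {x₃ i} sees)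

  seen-by-vertex : ∀ {u i} → vertexSeesTri adj u (T i) ≡ true →
                   ∃[ p ] ∃[ q ] ∃[ r ] Corners i p q r × adj u p ≡ true × adj u q ≡ true
  seen-by-vertex {u} {i} sees with isTriB adj u (x₁ i) (x₂ i) in u₁₂ | isTriB adj u (x₂ i) (x₃ i) in u₂₃
  ... | true  | _     = _ , _ , _ , corners i , outer (triangle-edges adj {u} {x₁ i} {x₂ i} u₁₂)
  ... | false | true  = _ , _ , _ , rotate (corners i) , outer (triangle-edges adj {u} {x₂ i} {x₃ i} u₂₃)
  ... | false | false = _ , _ , _ , swap (rotate (rotate (corners i))) ,
                        outer (triangle-edges adj {u} {x₁ i} {x₃ i} sees)

  apart₉ : ∀ {a b c x y z : Fin n} → a ≢ x → a ≢ y → a ≢ z → b ≢ x → b ≢ y → b ≢ z → c ≢ x → c ≢ y → c ≢ z →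
           Disjoint (a , b , c) (x , y , z)
  apart₉ ax ay az bx by bz cx cy cz = disjoint-by-vertices _ (∉-tri ax ay az) (∉-tri bx by bz) (∉-tri cx cy cz)

  avoids : ∀ {a b c P Q R} → a ∈ᴾ P → b ∈ᴾ Q → c ∈ᴾ R → ∀ i → P ≢ tri i → Q ≢ tri i → R ≢ tri i →
           Disjoint (a , b , c) (T i)
  avoids a∈ b∈ c∈ i P≢ Q≢ R≢ =
    disjoint-by-vertices (T i) (avoids-T a∈ i P≢) (avoids-T b∈ i Q≢) (avoids-T c∈ i R≢)

  outside : ∀ {i j} → i ≢ j → tri j ≢ tri i
  outside i≢j = tri≢ (≢-sym i≢j)

  -- T j = p q r is exchanged for u p q and l + r (the edge l of M with r)
  I-seen⇒¬complete-edge : ∀ {j l u} → u ∈ᴾ uncovered → vertexSeesTri adj u (T j) ≡ true →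
                         (∀ {v} → v ∈ᴾ tri j → adj (end₁ l) v ≡ true × adj (end₂ l) v ≡ true) → ⊥
  I-seen⇒¬complete-edge {j} {l} u∈ sees complete with seen-by-vertex sees
  ... | p , q , r , c , up , uq = no-k+1 (exchange₁₂ adj {F = T} T-disjoint {j}
        (is-tri adj up pq uq) (is-tri adj (M-adj l) (proj₂ (complete r∈)) (proj₁ (complete r∈)))
        (apart₉ (distinct u∈ a∈ λ ()) (distinct u∈ b∈ λ ()) (distinct u∈ r∈ λ ())
                (distinct p∈ a∈ λ ()) (distinct p∈ b∈ λ ()) p≢r
                (distinct q∈ a∈ λ ()) (distinct q∈ b∈ λ ()) q≢r)
        (λ i i≢j → avoids u∈ p∈ q∈ i (λ ()) (outside i≢j) (outside i≢j))
        (λ i i≢j → avoids a∈ b∈ r∈ i (λ ()) (λ ()) (outside i≢j)))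
    where
    open Corners c
    a∈ : end₁ l ∈ᴾ edge l
    a∈ = end₁∈ l
    b∈ : end₂ l ∈ᴾ edge l
    b∈ = end₂∈ l

  common-neighbour : ∀ {y x q r s} → 8 ≤ arcs adj (inTri (T y)) (inTri (T x)) →
                     q ∈ᴾ tri y → r ∈ᴾ tri y → s ∈ᴾ tri x →
                     ∃[ c ] c ∈ᴾ tri x × s ≢ c × adj c q ≡ true × adj c r ≡ true
  common-neighbour {y} {x} heavy q∈ r∈ s∈ with corners-at s∈
  ... | d , e , cx with arcs-heavy adj adj-sym (T y) (T x) heavy (∈tri⇒ q∈) (∈tri⇒ r∈)
                          (∈tri⇒ (Corners.q∈ cx)) (∈tri⇒ (Corners.r∈ cx)) (Corners.q≢r cx)
  ...   | inj₁ d-common = d , Corners.q∈ cx , Corners.p≢q cx , d-common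
  ...   | inj₂ e-common = e , Corners.r∈ cx , Corners.p≢r cx , e-common

  -- T y = p q r and T x are exchanged for g + p, h + s and c q r
  heavy⇒¬two-edge-seers : ∀ {y x} → y ≢ x → 8 ≤ arcs adj (inTri (T y)) (inTri (T x)) →
                 ∀ {g h} → g ≢ h → edgeSeesTri adj (M g) (T y) ≡ true → edgeSeesTri adj (M h) (T x) ≡ true → ⊥
  heavy⇒¬two-edge-seers {y} {x} y≢x heavy {g} {h} g≢h g-sees h-sees
    with seen-by-edge g-sees | seen-by-edge h-sees
  ... | p , q , r , cy , g₁p , g₂p | s , _ , _ , cx , h₁s , h₂s
    with common-neighbour heavy (Corners.q∈ cy) (Corners.r∈ cy) (Corners.p∈ cx)
  ... | c , c∈ , s≢c , cq , cr = no-k+1 (exchange₂₃ adj {F = T} T-disjoint {y} {x}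
      (is-tri adj (M-adj g) g₂p g₁p) (is-tri adj (M-adj h) h₂s h₁s) (is-tri adj cq qr cr)
      (apart₉ (distinct h₁∈ g₁∈ h≢g) (distinct h₁∈ g₂∈ h≢g) (distinct h₁∈ p∈ λ ())
              (distinct h₂∈ g₁∈ h≢g) (distinct h₂∈ g₂∈ h≢g) (distinct h₂∈ p∈ λ ())
              (distinct s∈ g₁∈ λ ()) (distinct s∈ g₂∈ λ ()) (distinct s∈ p∈ X≢Y))
      (apart₉ (distinct c∈ g₁∈ λ ()) (distinct c∈ g₂∈ λ ()) (distinct c∈ p∈ X≢Y)
              (distinct q∈ g₁∈ λ ()) (distinct q∈ g₂∈ λ ()) (≢-sym p≢q)
              (distinct r∈ g₁∈ λ ()) (distinct r∈ g₂∈ λ ()) (≢-sym p≢r))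
      (apart₉ (distinct h₁∈ c∈ λ ()) (distinct h₁∈ q∈ λ ()) (distinct h₁∈ r∈ λ ())
              (distinct h₂∈ c∈ λ ()) (distinct h₂∈ q∈ λ ()) (distinct h₂∈ r∈ λ ())
              s≢c (distinct s∈ q∈ X≢Y) (distinct s∈ r∈ X≢Y))
      (λ i i≢y → avoids g₁∈ g₂∈ p∈ i (λ ()) (λ ()) (outside i≢y))
      (λ i i≢y i≢x → avoids h₁∈ h₂∈ s∈ i (λ ()) (λ ()) (outside i≢x))
      (λ i i≢y i≢x → avoids c∈ q∈ r∈ i (outside i≢x) (outside i≢y) (outside i≢y)))
    where
    open Corners cy
    g₁∈ : end₁ g ∈ᴾ edge g
    g₁∈ = end₁∈ g
    g₂∈ : end₂ g ∈ᴾ edge g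
    g₂∈ = end₂∈ g
    h₁∈ : end₁ h ∈ᴾ edge h
    h₁∈ = end₁∈ h
    h₂∈ : end₂ h ∈ᴾ edge h
    h₂∈ = end₂∈ h
    s∈ : s ∈ᴾ tri x
    s∈ = Corners.p∈ cx
    h≢g : edge h ≢ edge g
    h≢g = edge≢ (≢-sym g≢h)
    X≢Y : tri x ≢ tri y
    X≢Y = tri≢ (≢-sym y≢x)

  -- T y₁ = p₁ q₁ r₁, T y₂ = p₂ q₂ r₂ and T x are exchanged for g + p₁, h + p₂, a q₁ r₁ and b q₂ r₂
  two-heavy⇒¬two-edge-seers : ∀ {y₁ y₂ x} → y₁ ≢ y₂ → y₁ ≢ x → y₂ ≢ x →
                     8 ≤ arcs adj (inTri (T y₁)) (inTri (T x)) → 8 ≤ arcs adj (inTri (T y₂)) (inTri (T x)) →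
                     ∀ {g h} → g ≢ h →
                     edgeSeesTri adj (M g) (T y₁) ≡ true → edgeSeesTri adj (M h) (T y₂) ≡ true → ⊥
  two-heavy⇒¬two-edge-seers {y₁} {y₂} {x} y₁≢y₂ y₁≢x y₂≢x heavy₁ heavy₂ {g} {h} g≢h g-sees h-sees
    with seen-by-edge g-sees | seen-by-edge h-sees
  ... | p₁ , q₁ , r₁ , cy₁ , g₁p₁ , g₂p₁ | p₂ , q₂ , r₂ , cy₂ , h₁p₂ , h₂p₂
    with common-neighbour heavy₁ (Corners.q∈ cy₁) (Corners.r∈ cy₁) (Corners.p∈ (corners x))
  ... | a , a∈ , _ , aq₁ , ar₁
    with common-neighbour heavy₂ (Corners.q∈ cy₂) (Corners.r∈ cy₂) a∈
  ... | b , b∈ , a≢b , bq₂ , br₂ = no-k+1 (exchange₃₄ adj {F = T} T-disjoint {y₁} {y₂} {x}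
      (is-tri adj (M-adj g) g₂p₁ g₁p₁) (is-tri adj (M-adj h) h₂p₂ h₁p₂)
      (is-tri adj aq₁ Y₁.qr ar₁) (is-tri adj bq₂ Y₂.qr br₂)
      (apart₉ (distinct h₁∈ g₁∈ h≢g) (distinct h₁∈ g₂∈ h≢g) (distinct h₁∈ Y₁.p∈ λ ())
              (distinct h₂∈ g₁∈ h≢g) (distinct h₂∈ g₂∈ h≢g) (distinct h₂∈ Y₁.p∈ λ ())
              (distinct Y₂.p∈ g₁∈ λ ()) (distinct Y₂.p∈ g₂∈ λ ()) (distinct Y₂.p∈ Y₁.p∈ Y₂≢Y₁))
      (apart₉ (distinct a∈ g₁∈ λ ()) (distinct a∈ g₂∈ λ ()) (distinct a∈ Y₁.p∈ X≢Y₁)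
              (distinct Y₁.q∈ g₁∈ λ ()) (distinct Y₁.q∈ g₂∈ λ ()) (≢-sym Y₁.p≢q)
              (distinct Y₁.r∈ g₁∈ λ ()) (distinct Y₁.r∈ g₂∈ λ ()) (≢-sym Y₁.p≢r))
      (apart₉ (distinct b∈ g₁∈ λ ()) (distinct b∈ g₂∈ λ ()) (distinct b∈ Y₁.p∈ X≢Y₁)
              (distinct Y₂.q∈ g₁∈ λ ()) (distinct Y₂.q∈ g₂∈ λ ()) (distinct Y₂.q∈ Y₁.p∈ Y₂≢Y₁)
              (distinct Y₂.r∈ g₁∈ λ ()) (distinct Y₂.r∈ g₂∈ λ ()) (distinct Y₂.r∈ Y₁.p∈ Y₂≢Y₁))
      (apart₉ (distinct a∈ h₁∈ λ ()) (distinct a∈ h₂∈ λ ()) (distinct a∈ Y₂.p∈ X≢Y₂)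
              (distinct Y₁.q∈ h₁∈ λ ()) (distinct Y₁.q∈ h₂∈ λ ()) (distinct Y₁.q∈ Y₂.p∈ Y₁≢Y₂)
              (distinct Y₁.r∈ h₁∈ λ ()) (distinct Y₁.r∈ h₂∈ λ ()) (distinct Y₁.r∈ Y₂.p∈ Y₁≢Y₂))
      (apart₉ (distinct b∈ h₁∈ λ ()) (distinct b∈ h₂∈ λ ()) (distinct b∈ Y₂.p∈ X≢Y₂)
              (distinct Y₂.q∈ h₁∈ λ ()) (distinct Y₂.q∈ h₂∈ λ ()) (≢-sym Y₂.p≢q)
              (distinct Y₂.r∈ h₁∈ λ ()) (distinct Y₂.r∈ h₂∈ λ ()) (≢-sym Y₂.p≢r))
      (apart₉ a≢b (distinct a∈ Y₂.q∈ X≢Y₂) (distinct a∈ Y₂.r∈ X≢Y₂)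
              (distinct Y₁.q∈ b∈ Y₁≢X) (distinct Y₁.q∈ Y₂.q∈ Y₁≢Y₂) (distinct Y₁.q∈ Y₂.r∈ Y₁≢Y₂)
              (distinct Y₁.r∈ b∈ Y₁≢X) (distinct Y₁.r∈ Y₂.q∈ Y₁≢Y₂) (distinct Y₁.r∈ Y₂.r∈ Y₁≢Y₂))
      (λ i i≢y₁ → avoids g₁∈ g₂∈ Y₁.p∈ i (λ ()) (λ ()) (outside i≢y₁))
      (λ i _ i≢y₂ → avoids h₁∈ h₂∈ Y₂.p∈ i (λ ()) (λ ()) (outside i≢y₂))
      (λ i i≢y₁ _ i≢x → avoids a∈ Y₁.q∈ Y₁.r∈ i (outside i≢x) (outside i≢y₁) (outside i≢y₁))
      (λ i _ i≢y₂ i≢x → avoids b∈ Y₂.q∈ Y₂.r∈ i (outside i≢x) (outside i≢y₂) (outside i≢y₂)))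
    where
    module Y₁ = Corners cy₁
    module Y₂ = Corners cy₂
    g₁∈ : end₁ g ∈ᴾ edge g
    g₁∈ = end₁∈ g
    g₂∈ : end₂ g ∈ᴾ edge g
    g₂∈ = end₂∈ g
    h₁∈ : end₁ h ∈ᴾ edge h
    h₁∈ = end₁∈ h
    h₂∈ : end₂ h ∈ᴾ edge h
    h₂∈ = end₂∈ h
    h≢g : edge h ≢ edge g
    h≢g = edge≢ (≢-sym g≢h)
    Y₁≢Y₂ : tri y₁ ≢ tri y₂
    Y₁≢Y₂ = tri≢ y₁≢y₂
    Y₂≢Y₁ : tri y₂ ≢ tri y₁
    Y₂≢Y₁ = ≢-sym Y₁≢Y₂
    Y₁≢X : tri y₁ ≢ tri x
    Y₁≢X = tri≢ y₁≢x
    X≢Y₁ : tri x ≢ tri y₁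
    X≢Y₁ = ≢-sym Y₁≢X
    X≢Y₂ : tri x ≢ tri y₂
    X≢Y₂ = ≢-sym (tri≢ y₂≢x)

  avoids-M : ∀ {v P} → v ∈ᴾ P → ∀ l → P ≢ edge l → inEdge (M l) v ≡ false
  avoids-M {v} v∈ l P≢ with inEdge (M l) v in v∈l
  ... | false = refl
  ... | true  = ⊥-elim (P≢ (part-unique v∈ (in-edge v∈l)))

  augment : ∀ {F : Fin k → Tri n} → IsDisjointTriangles adj F →
            (∀ {v l} → v ∈ᴾ edge l → ∀ i → inTri (F i) v ≡ false) →
            ∀ {z w} → adj z w ≡ true → (∀ l → inEdge (M l) z ≡ false) → (∀ l → inEdge (M l) w ≡ false) →
            (∀ i → inTri (F i) z ≡ false) → (∀ i → inTri (F i) w ≡ false) → ⊥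
  augment {F} F-disj M∉F {z} {w} zw z∉M w∉M z∉F w∉F = 1+n≰n (T-optimal F F-disj (suc m) (cons-edge (z , w) M)
    (matching-extend adj {F = F}
       (M-adj , proj₁ (proj₂ M-matching) , λ l v v∈ → anyFin-none (M∉F {v} {l} (in-edge v∈)))
                     zw z∉M w∉M (anyFin-none z∉F) (anyFin-none w∉F)))

  full-adjacent : ∀ {y x s t} → 9 ≤ arcs adj (inTri (T y)) (inTri (T x)) →
                  s ∈ᴾ tri y → t ∈ᴾ tri x → adj s t ≡ true
  full-adjacent {y} {x} full s∈ t∈ = arcs-full adj (T y) (T x) full (∈tri⇒ s∈) (∈tri⇒ t∈)

  -- T y = a b c and T x = v d e are exchanged for u a b and c d e, which frees the edge v w
  full⇒¬I-neighbour : ∀ {y x} → y ≢ x → 9 ≤ arcs adj (inTri (T y)) (inTri (T x)) →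
                  ∀ {u} → u ∈ᴾ uncovered → vertexSeesTri adj u (T y) ≡ true →
                  ∀ {w v} → w ∈ᴾ uncovered → w ≢ u → v ∈ᴾ tri x → adj w v ≡ true → ⊥
  full⇒¬I-neighbour {y} {x} y≢x full {u} u∈ u-sees {w} {v} w∈ w≢u v∈ wv
    with seen-by-vertex u-sees | corners-at v∈
  ... | a , b , c , cy , ua , ub | d , e , cx =
    augment (replaced₂-disjoint adj T-disjoint {y} {x}
               (is-tri adj ua pq ub)
               (is-tri adj (full-adjacent full r∈ X.q∈) X.qr (full-adjacent full r∈ X.r∈))
               (apart₉ (distinct r∈ u∈ λ ()) (≢-sym p≢r) (≢-sym q≢r)
                       (distinct X.q∈ u∈ λ ()) (distinct X.q∈ p∈ X≢Y) (distinct X.q∈ q∈ X≢Y)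
                       (distinct X.r∈ u∈ λ ()) (distinct X.r∈ p∈ X≢Y) (distinct X.r∈ q∈ X≢Y))
               (λ i i≢y → avoids u∈ p∈ q∈ i (λ ()) (outside i≢y) (outside i≢y))
               (λ i i≢y i≢x → avoids r∈ X.q∈ X.r∈ i (outside i≢y) (outside i≢x) (outside i≢x)))
            (λ z∈ → F-avoids (distinct z∈ u∈ λ ()) (distinct z∈ p∈ λ ()) (distinct z∈ q∈ λ ())
                             (distinct z∈ r∈ λ ()) (distinct z∈ X.q∈ λ ()) (distinct z∈ X.r∈ λ ())
                             (λ i _ _ → avoids-T z∈ i (λ ())))
            (trans (adj-sym v w) wv) (λ l → avoids-M v∈ l (λ ())) (λ l → avoids-M w∈ l (λ ()))
            (F-avoids (distinct v∈ u∈ λ ()) (distinct v∈ p∈ X≢Y) (distinct v∈ q∈ X≢Y)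
                      (distinct v∈ r∈ X≢Y) X.p≢q X.p≢r (λ i _ i≢x → avoids-T v∈ i (outside i≢x)))
            (F-avoids w≢u (distinct w∈ p∈ λ ()) (distinct w∈ q∈ λ ())
                      (distinct w∈ r∈ λ ()) (distinct w∈ X.q∈ λ ()) (distinct w∈ X.r∈ λ ())
                      (λ i _ _ → avoids-T w∈ i (λ ())))
    where
    open Corners cy
    module X = Corners cx
    X≢Y : tri x ≢ tri y
    X≢Y = tri≢ (≢-sym y≢x)
    F-avoids : ∀ {z} → z ≢ u → z ≢ a → z ≢ b → z ≢ c → z ≢ d → z ≢ e →
               (∀ i → i ≢ y → i ≢ x → inTri (T i) z ≡ false) →
               ∀ i → inTri (replace (replace T y (u , a , b)) x (c , d , e) i) z ≡ false
    F-avoids {z} zu za zb zc zd ze =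
      replaced₂-avoids T y x (u , a , b) (c , d , e) z (∉-tri zu za zb) (∉-tri zc zd ze)

  -- T y = p q r and T x = s t w are exchanged for g + p, u s t and q r w
  full⇒¬edge-and-I-seer : ∀ {y x} → y ≢ x → 9 ≤ arcs adj (inTri (T y)) (inTri (T x)) →
                          ∀ {g u} → edgeSeesTri adj (M g) (T y) ≡ true →
                          u ∈ᴾ uncovered → vertexSeesTri adj u (T x) ≡ true → ⊥
  full⇒¬edge-and-I-seer {y} {x} y≢x full {g} {u} g-sees u∈ u-sees
    with seen-by-edge g-sees | seen-by-vertex u-sees
  ... | p , q , r , cy , g₁p , g₂p | s , t , w , cx , us , ut = no-k+1 (exchange₂₃ adj {F = T} T-disjoint {y} {x}
      (is-tri adj (M-adj g) g₂p g₁p) (is-tri adj us X.pq ut)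
      (is-tri adj qr (full-adjacent full r∈ X.r∈) (full-adjacent full q∈ X.r∈))
      (apart₉ (distinct u∈ g₁∈ λ ()) (distinct u∈ g₂∈ λ ()) (distinct u∈ p∈ λ ())
              (distinct X.p∈ g₁∈ λ ()) (distinct X.p∈ g₂∈ λ ()) (distinct X.p∈ p∈ X≢Y)
              (distinct X.q∈ g₁∈ λ ()) (distinct X.q∈ g₂∈ λ ()) (distinct X.q∈ p∈ X≢Y))
      (apart₉ (distinct q∈ g₁∈ λ ()) (distinct q∈ g₂∈ λ ()) (≢-sym p≢q)
              (distinct r∈ g₁∈ λ ()) (distinct r∈ g₂∈ λ ()) (≢-sym p≢r)
              (distinct X.r∈ g₁∈ λ ()) (distinct X.r∈ g₂∈ λ ()) (distinct X.r∈ p∈ X≢Y))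
      (apart₉ (distinct u∈ q∈ λ ()) (distinct u∈ r∈ λ ()) (distinct u∈ X.r∈ λ ())
              (distinct X.p∈ q∈ X≢Y) (distinct X.p∈ r∈ X≢Y) X.p≢r
              (distinct X.q∈ q∈ X≢Y) (distinct X.q∈ r∈ X≢Y) X.q≢r)
      (λ i i≢y → avoids g₁∈ g₂∈ p∈ i (λ ()) (λ ()) (outside i≢y))
      (λ i _ i≢x → avoids u∈ X.p∈ X.q∈ i (λ ()) (outside i≢x) (outside i≢x))
      (λ i i≢y i≢x → avoids q∈ r∈ X.r∈ i (outside i≢y) (outside i≢y) (outside i≢x)))
    where
    open Corners cy
    module X = Corners cx
    g₁∈ : end₁ g ∈ᴾ edge g
    g₁∈ = end₁∈ g
    g₂∈ : end₂ g ∈ᴾ edge g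
    g₂∈ = end₂∈ g
    X≢Y : tri x ≢ tri y
    X≢Y = tri≢ (≢-sym y≢x)

  -- T y₁ = a₁ b₁ c₁, T y₂ = p₂ q₂ r₂ and T x = x₁ x₂ x₃ are exchanged for g + p₂, u a₁ b₁, c₁ x₁ x₂
  -- and q₂ r₂ x₃
  two-full⇒¬I-and-edge-seer : ∀ {y₁ y₂ x} → y₁ ≢ y₂ → y₁ ≢ x → y₂ ≢ x →
                    9 ≤ arcs adj (inTri (T y₁)) (inTri (T x)) → 9 ≤ arcs adj (inTri (T y₂)) (inTri (T x)) →
                    ∀ {u g} → u ∈ᴾ uncovered →
                    vertexSeesTri adj u (T y₁) ≡ true → edgeSeesTri adj (M g) (T y₂) ≡ true → ⊥
  two-full⇒¬I-and-edge-seer {y₁} {y₂} {x} y₁≢y₂ y₁≢x y₂≢x full₁ full₂ {u} {g} u∈ u-sees g-sees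
    with seen-by-vertex u-sees | seen-by-edge g-sees
  ... | a₁ , b₁ , c₁ , cy₁ , ua₁ , ub₁ | p₂ , q₂ , r₂ , cy₂ , g₁p₂ , g₂p₂ =
    no-k+1 (exchange₃₄ adj {F = T} T-disjoint {y₂} {y₁} {x}
      (is-tri adj (M-adj g) g₂p₂ g₁p₂) (is-tri adj ua₁ Y₁.pq ub₁)
      (is-tri adj (full-adjacent full₁ Y₁.r∈ X.p∈) X.pq (full-adjacent full₁ Y₁.r∈ X.q∈))
      (is-tri adj Y₂.qr (full-adjacent full₂ Y₂.r∈ X.r∈) (full-adjacent full₂ Y₂.q∈ X.r∈))
      (apart₉ (distinct u∈ g₁∈ λ ()) (distinct u∈ g₂∈ λ ()) (distinct u∈ Y₂.p∈ λ ())
              (distinct Y₁.p∈ g₁∈ λ ()) (distinct Y₁.p∈ g₂∈ λ ()) (distinct Y₁.p∈ Y₂.p∈ Y₁≢Y₂)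
              (distinct Y₁.q∈ g₁∈ λ ()) (distinct Y₁.q∈ g₂∈ λ ()) (distinct Y₁.q∈ Y₂.p∈ Y₁≢Y₂))
      (apart₉ (distinct Y₁.r∈ g₁∈ λ ()) (distinct Y₁.r∈ g₂∈ λ ()) (distinct Y₁.r∈ Y₂.p∈ Y₁≢Y₂)
              (distinct X.p∈ g₁∈ λ ()) (distinct X.p∈ g₂∈ λ ()) (distinct X.p∈ Y₂.p∈ X≢Y₂)
              (distinct X.q∈ g₁∈ λ ()) (distinct X.q∈ g₂∈ λ ()) (distinct X.q∈ Y₂.p∈ X≢Y₂))
      (apart₉ (distinct Y₂.q∈ g₁∈ λ ()) (distinct Y₂.q∈ g₂∈ λ ()) (≢-sym Y₂.p≢q)
              (distinct Y₂.r∈ g₁∈ λ ()) (distinct Y₂.r∈ g₂∈ λ ()) (≢-sym Y₂.p≢r)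
              (distinct X.r∈ g₁∈ λ ()) (distinct X.r∈ g₂∈ λ ()) (distinct X.r∈ Y₂.p∈ X≢Y₂))
      (apart₉ (distinct Y₁.r∈ u∈ λ ()) (≢-sym Y₁.p≢r) (≢-sym Y₁.q≢r)
              (distinct X.p∈ u∈ λ ()) (distinct X.p∈ Y₁.p∈ X≢Y₁) (distinct X.p∈ Y₁.q∈ X≢Y₁)
              (distinct X.q∈ u∈ λ ()) (distinct X.q∈ Y₁.p∈ X≢Y₁) (distinct X.q∈ Y₁.q∈ X≢Y₁))
      (apart₉ (distinct Y₂.q∈ u∈ λ ()) (distinct Y₂.q∈ Y₁.p∈ Y₂≢Y₁) (distinct Y₂.q∈ Y₁.q∈ Y₂≢Y₁)
              (distinct Y₂.r∈ u∈ λ ()) (distinct Y₂.r∈ Y₁.p∈ Y₂≢Y₁) (distinct Y₂.r∈ Y₁.q∈ Y₂≢Y₁)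
              (distinct X.r∈ u∈ λ ()) (distinct X.r∈ Y₁.p∈ X≢Y₁) (distinct X.r∈ Y₁.q∈ X≢Y₁))
      (apart₉ (distinct Y₁.r∈ Y₂.q∈ Y₁≢Y₂) (distinct Y₁.r∈ Y₂.r∈ Y₁≢Y₂) (distinct Y₁.r∈ X.r∈ Y₁≢X)
              (distinct X.p∈ Y₂.q∈ X≢Y₂) (distinct X.p∈ Y₂.r∈ X≢Y₂) X.p≢r
              (distinct X.q∈ Y₂.q∈ X≢Y₂) (distinct X.q∈ Y₂.r∈ X≢Y₂) X.q≢r)
      (λ i i≢y₂ → avoids g₁∈ g₂∈ Y₂.p∈ i (λ ()) (λ ()) (outside i≢y₂))
      (λ i _ i≢y₁ → avoids u∈ Y₁.p∈ Y₁.q∈ i (λ ()) (outside i≢y₁) (outside i≢y₁))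
      (λ i _ i≢y₁ i≢x → avoids Y₁.r∈ X.p∈ X.q∈ i (outside i≢y₁) (outside i≢x) (outside i≢x))
      (λ i i≢y₂ _ i≢x → avoids Y₂.q∈ Y₂.r∈ X.r∈ i (outside i≢y₂) (outside i≢y₂) (outside i≢x)))
    where
    module Y₁ = Corners cy₁
    module Y₂ = Corners cy₂
    module X = Corners (corners x)
    g₁∈ : end₁ g ∈ᴾ edge g
    g₁∈ = end₁∈ g
    g₂∈ : end₂ g ∈ᴾ edge g
    g₂∈ = end₂∈ g
    Y₁≢Y₂ : tri y₁ ≢ tri y₂
    Y₁≢Y₂ = tri≢ y₁≢y₂
    Y₂≢Y₁ : tri y₂ ≢ tri y₁
    Y₂≢Y₁ = ≢-sym Y₁≢Y₂
    Y₁≢X : tri y₁ ≢ tri x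
    Y₁≢X = tri≢ y₁≢x
    X≢Y₁ : tri x ≢ tri y₁
    X≢Y₁ = ≢-sym Y₁≢X
    X≢Y₂ : tri x ≢ tri y₂
    X≢Y₂ = ≢-sym (tri≢ y₂≢x)

  -- T y₁ = a₁ b₁ c₁, T y₂ = a₂ b₂ c₂ and T x = x₁ x₂ x₃ are exchanged for u₁ a₁ b₁, u₂ a₂ b₂ and
  -- c₁ x₁ x₂, which frees the edge c₂ x₃
  two-full⇒¬two-I-seers : ∀ {y₁ y₂ x} → y₁ ≢ y₂ → y₁ ≢ x → y₂ ≢ x →
                        9 ≤ arcs adj (inTri (T y₁)) (inTri (T x)) → 9 ≤ arcs adj (inTri (T y₂)) (inTri (T x)) →
                        ∀ {u₁ u₂} → u₁ ∈ᴾ uncovered → vertexSeesTri adj u₁ (T y₁) ≡ true →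
                        u₂ ∈ᴾ uncovered → vertexSeesTri adj u₂ (T y₂) ≡ true → u₁ ≢ u₂ → ⊥
  two-full⇒¬two-I-seers {y₁} {y₂} {x} y₁≢y₂ y₁≢x y₂≢x full₁ full₂ {u₁} {u₂} u₁∈ u₁-sees u₂∈ u₂-sees u₁≢u₂
    with seen-by-vertex u₁-sees | seen-by-vertex u₂-sees
  ... | a₁ , b₁ , c₁ , cy₁ , u₁a₁ , u₁b₁ | a₂ , b₂ , c₂ , cy₂ , u₂a₂ , u₂b₂ =
    augment (replaced₃-disjoint adj T-disjoint {y₁} {y₂} {x}
               (is-tri adj u₁a₁ Y₁.pq u₁b₁) (is-tri adj u₂a₂ Y₂.pq u₂b₂)
               (is-tri adj (full-adjacent full₁ Y₁.r∈ X.p∈) X.pq (full-adjacent full₁ Y₁.r∈ X.q∈))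
               (apart₉ (≢-sym u₁≢u₂) (distinct u₂∈ Y₁.p∈ λ ()) (distinct u₂∈ Y₁.q∈ λ ())
                       (distinct Y₂.p∈ u₁∈ λ ()) (distinct Y₂.p∈ Y₁.p∈ Y₂≢Y₁) (distinct Y₂.p∈ Y₁.q∈ Y₂≢Y₁)
                       (distinct Y₂.q∈ u₁∈ λ ()) (distinct Y₂.q∈ Y₁.p∈ Y₂≢Y₁) (distinct Y₂.q∈ Y₁.q∈ Y₂≢Y₁))
               (apart₉ (distinct Y₁.r∈ u₁∈ λ ()) (≢-sym Y₁.p≢r) (≢-sym Y₁.q≢r)
                       (distinct X.p∈ u₁∈ λ ()) (distinct X.p∈ Y₁.p∈ X≢Y₁) (distinct X.p∈ Y₁.q∈ X≢Y₁)
                       (distinct X.q∈ u₁∈ λ ()) (distinct X.q∈ Y₁.p∈ X≢Y₁) (distinct X.q∈ Y₁.q∈ X≢Y₁))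
               (apart₉ (distinct Y₁.r∈ u₂∈ λ ()) (distinct Y₁.r∈ Y₂.p∈ Y₁≢Y₂) (distinct Y₁.r∈ Y₂.q∈ Y₁≢Y₂)
                       (distinct X.p∈ u₂∈ λ ()) (distinct X.p∈ Y₂.p∈ X≢Y₂) (distinct X.p∈ Y₂.q∈ X≢Y₂)
                       (distinct X.q∈ u₂∈ λ ()) (distinct X.q∈ Y₂.p∈ X≢Y₂) (distinct X.q∈ Y₂.q∈ X≢Y₂))
               (λ i i≢y₁ → avoids u₁∈ Y₁.p∈ Y₁.q∈ i (λ ()) (outside i≢y₁) (outside i≢y₁))
               (λ i _ i≢y₂ → avoids u₂∈ Y₂.p∈ Y₂.q∈ i (λ ()) (outside i≢y₂) (outside i≢y₂))
               (λ i i≢y₁ _ i≢x → avoids Y₁.r∈ X.p∈ X.q∈ i (outside i≢y₁) (outside i≢x) (outside i≢x)))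
            (λ v∈ → F-avoids (distinct v∈ u₁∈ λ ()) (distinct v∈ Y₁.p∈ λ ()) (distinct v∈ Y₁.q∈ λ ())
                             (distinct v∈ u₂∈ λ ()) (distinct v∈ Y₂.p∈ λ ()) (distinct v∈ Y₂.q∈ λ ())
                             (distinct v∈ Y₁.r∈ λ ()) (distinct v∈ X.p∈ λ ()) (distinct v∈ X.q∈ λ ())
                             (λ i _ _ _ → avoids-T v∈ i (λ ())))
            (full-adjacent full₂ Y₂.r∈ X.r∈) (λ l → avoids-M Y₂.r∈ l (λ ())) (λ l → avoids-M X.r∈ l (λ ()))
            (F-avoids (distinct Y₂.r∈ u₁∈ λ ()) (distinct Y₂.r∈ Y₁.p∈ Y₂≢Y₁) (distinct Y₂.r∈ Y₁.q∈ Y₂≢Y₁)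
                      (distinct Y₂.r∈ u₂∈ λ ()) (≢-sym Y₂.p≢r) (≢-sym Y₂.q≢r)
                      (distinct Y₂.r∈ Y₁.r∈ Y₂≢Y₁) (distinct Y₂.r∈ X.p∈ Y₂≢X) (distinct Y₂.r∈ X.q∈ Y₂≢X)
                      (λ i _ i≢y₂ _ → avoids-T Y₂.r∈ i (outside i≢y₂)))
            (F-avoids (distinct X.r∈ u₁∈ λ ()) (distinct X.r∈ Y₁.p∈ X≢Y₁) (distinct X.r∈ Y₁.q∈ X≢Y₁)
                      (distinct X.r∈ u₂∈ λ ()) (distinct X.r∈ Y₂.p∈ X≢Y₂) (distinct X.r∈ Y₂.q∈ X≢Y₂)
                      (distinct X.r∈ Y₁.r∈ X≢Y₁) (≢-sym X.p≢r) (≢-sym X.q≢r)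
                      (λ i _ _ i≢x → avoids-T X.r∈ i (outside i≢x)))
    where
    module Y₁ = Corners cy₁
    module Y₂ = Corners cy₂
    module X = Corners (corners x)
    Y₁≢Y₂ : tri y₁ ≢ tri y₂
    Y₁≢Y₂ = tri≢ y₁≢y₂
    Y₂≢Y₁ : tri y₂ ≢ tri y₁
    Y₂≢Y₁ = ≢-sym Y₁≢Y₂
    Y₂≢X : tri y₂ ≢ tri x
    Y₂≢X = tri≢ y₂≢x
    X≢Y₁ : tri x ≢ tri y₁
    X≢Y₁ = ≢-sym (tri≢ y₁≢x)
    X≢Y₂ : tri x ≢ tri y₂
    X≢Y₂ = ≢-sym Y₂≢X
    F-avoids : ∀ {v} → v ≢ u₁ → v ≢ a₁ → v ≢ b₁ → v ≢ u₂ → v ≢ a₂ → v ≢ b₂ → v ≢ c₁ → v ≢ x₁ x → v ≢ x₂ x →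
               (∀ i → i ≢ y₁ → i ≢ y₂ → i ≢ x → inTri (T i) v ≡ false) →
               ∀ i → inTri (replace (replace (replace T y₁ (u₁ , a₁ , b₁)) y₂ (u₂ , a₂ , b₂))
                                    x (c₁ , x₁ x , x₂ x) i) v ≡ false
    F-avoids {v} vu₁ va₁ vb₁ vu₂ va₂ vb₂ vc₁ vx₁ vx₂ =
      replaced₃-avoids T y₁ y₂ x (u₁ , a₁ , b₁) (u₂ , a₂ , b₂) (c₁ , x₁ x , x₂ x) v
                       (∉-tri vu₁ va₁ vb₁) (∉-tri vu₂ va₂ vb₂) (∉-tri vc₁ vx₁ vx₂)

  T₁ T₂ : Fin k → Bool
  T₁ = inT1 adj T M
  T₂ = inT2 adj T M

  M-seers : Fin k → Fin m → Bool
  M-seers j l = edgeSeesTri adj (M l) (T j)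

  I-seers : Fin k → Fin n → Bool
  I-seers j u = I u ∧ vertexSeesTri adj u (T j)

  ¬T₁⇒≤1-M-seer : ∀ {j} → T₁ j ≡ false → count (M-seers j) ≤ 1
  ¬T₁⇒≤1-M-seer ¬T₁j = ≤-pred (≤ᵇ-false ¬T₁j)

  another-M-seer : ∀ {j} → T₁ j ≡ true → ∀ l → ∃[ g ] g ≢ l × edgeSeesTri adj (M g) (T j) ≡ true
  another-M-seer T₁j = count-another (≤ᵇ-true T₁j)

  T₂-cases : ∀ {j} → T₂ j ≡ true →
             T₁ j ≡ false × ((1 ≤ count (M-seers j) × 1 ≤ count (I-seers j)) ⊎ 2 ≤ count (I-seers j))
  T₂-cases {j} T₂j
    with split (T₁ j) (1 ≤ᵇ count (M-seers j)) (1 ≤ᵇ count (I-seers j)) (2 ≤ᵇ count (I-seers j)) T₂j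
    where
    split : ∀ a b c d → not a ∧ ((b ∧ c) ∨ d) ≡ true → a ≡ false × ((b ≡ true × c ≡ true) ⊎ d ≡ true)
    split false true  true  _    _ = refl , inj₁ (refl , refl)
    split false true  false true _ = refl , inj₂ refl
    split false false _     true _ = refl , inj₂ refl
  ... | ¬T₁j , inj₁ (M₁ , I₁) = ¬T₁j , inj₁ (≤ᵇ-true M₁ , ≤ᵇ-true I₁)
  ... | ¬T₁j , inj₂ I₂        = ¬T₁j , inj₂ (≤ᵇ-true I₂)

  D₀-cases : ∀ {j} → D₀ adj T M j ≡ true → T₁ j ≡ false × T₂ j ≡ false × count (I-seers j) ≤ 1
  D₀-cases {j} D₀j
    with split (T₁ j) (1 ≤ᵇ count (M-seers j)) (1 ≤ᵇ count (I-seers j)) (2 ≤ᵇ count (I-seers j)) D₀j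
    where
    split : ∀ a b c d → not a ∧ not (not a ∧ ((b ∧ c) ∨ d)) ≡ true →
            a ≡ false × not a ∧ ((b ∧ c) ∨ d) ≡ false × d ≡ false
    split false true  true  _     ()
    split false true  false false _ = refl , refl , refl
    split false false _     false _ = refl , refl , refl
    split false true  false true  ()
    split false false _     true  ()
  ... | ¬T₁j , ¬T₂j , ¬I₂ = ¬T₁j , ¬T₂j , ≤-pred (≤ᵇ-false ¬I₂)

  I-seer : ∀ {j} → 1 ≤ count (I-seers j) → ∃[ u ] u ∈ᴾ uncovered × vertexSeesTri adj u (T j) ≡ true
  I-seer 1≤ with count-witness 1≤
  ... | u , h = u , in-I (∧-fst (I u) h) , ∧-snd (I u) h

  T₂⇒I-seer : ∀ {j} → T₂ j ≡ true → ∃[ u ] u ∈ᴾ uncovered × vertexSeesTri adj u (T j) ≡ true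
  T₂⇒I-seer T₂j with proj₂ (T₂-cases T₂j)
  ... | inj₁ (_ , I₁) = I-seer I₁
  ... | inj₂ I₂       = I-seer (≤-trans (s≤s z≤n) I₂)

  from-M : Fin k → ℕ
  from-M j = sumFin λ l → arcs adj (inEdge (M l)) (inTri (T j))

  edge-to-T : ∀ l j → arcs adj (inEdge (M l)) (inTri (T j)) ≤ 3 + bit (M-seers j l) * 3
  edge-to-T l j = edge-to-triangle adj adj-sym (T j) (M-adj l)

  unseeing-edge-to-T : ∀ {l j} → M-seers j l ≡ false → arcs adj (inEdge (M l)) (inTri (T j)) ≤ 3
  unseeing-edge-to-T {l} {j} unseen = ≤-trans (edge-to-T l j) (≤-reflexive (cong (λ b → 3 + bit b * 3) unseen))

  from-M-≤ : ∀ j → from-M j ≤ m * 3 + count (M-seers j) * 3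
  from-M-≤ j = sum-≤-affine (M-seers j) 3 3 (λ l → edge-to-T l j)

  -- an edge of M completely joined to a triangle of T₂ would contradict I-seen⇒¬complete-edge
  from-M-≤-T₂ : ∀ {j} → T₂ j ≡ true → from-M j ≤ m * 3 + count (M-seers j) * 2
  from-M-≤-T₂ {j} T₂j = sum-≤-affine (M-seers j) 3 2 edge-bound
    where
    edge-bound : ∀ l → arcs adj (inEdge (M l)) (inTri (T j)) ≤ 3 + bit (M-seers j l) * 2
    edge-bound l with M-seers j l in sees | 6 ≤? arcs adj (inEdge (M l)) (inTri (T j))
    ... | false | _     = unseeing-edge-to-T sees
    ... | true  | no 6≰ = ≤-pred (≰⇒> 6≰)
    ... | true  | yes 6≤ with T₂⇒I-seer T₂j
    ...   | u , u∈ , u-sees = ⊥-elim (I-seen⇒¬complete-edge u∈ u-sees (λ v∈ →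
            complete (∈-edge₁ (end₁ l) (end₂ l)) (∈tri⇒ v∈) , complete (∈-edge₂ (end₁ l) (end₂ l)) (∈tri⇒ v∈)))
      where
      complete : ∀ {a b} → inEdge (M l) a ≡ true → inTri (T j) b ≡ true → adj a b ≡ true
      complete = arcs-complete adj (inEdge (M l)) (inTri (T j)) 2 3 (count-inEdge (M l)) (count-inTri (T j)) 6≤

  from-T : (Fin k → Bool) → Fin k → ℕ
  from-T P j = from-family adj T P (inTri (T j))

  -- a triangle outside T₁ has at most one heavy neighbour in T₁, and then no edge of M sees it
  from-T₁-≤ : ∀ {j} → T₁ j ≡ false →
              (from-T T₁ j ≤ count T₁ * 7 + 2 × from-M j ≤ m * 3) ⊎ from-T T₁ j ≤ count T₁ * 7
  from-T₁-≤ {j} ¬T₁j with any? (λ i → (T₁ i Data.Bool.≟ true) ×-dec (8 ≤? arcs adj (inTri (T i)) (inTri (T j))))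
  ... | no none = inj₂ (from-family-≤ adj T T₁ _ 7 (λ i T₁i → ≤-pred (≰⇒> (λ heavy → none (i , T₁i , heavy)))))
  ... | yes (i₀ , T₁i₀ , heavy₀) =
    inj₁ (from-family-≤-except adj T T₁ _ 7 2 i₀ light (arcs-triangles-≤9 adj (T i₀) (T j)) ,
          ≤-trans (sum-mono unseen) (≤-reflexive (sum-const {m} 3)))
    where
    ≢j : ∀ {i} → T₁ i ≡ true → i ≢ j
    ≢j T₁i refl = true≢false (trans (sym T₁i) ¬T₁j)
    light : ∀ i → T₁ i ≡ true → i ≢ i₀ → arcs adj (inTri (T i)) (inTri (T j)) ≤ 7
    light i T₁i i≢i₀ with 8 ≤? arcs adj (inTri (T i)) (inTri (T j))
    ... | no 8≰ = ≤-pred (≰⇒> 8≰)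
    ... | yes heavy with count-witness (≤-trans (s≤s z≤n) (≤ᵇ-true T₁i₀))
    ...   | g , g-sees with another-M-seer T₁i g
    ...     | h , h≢g , h-sees =
      ⊥-elim (two-heavy⇒¬two-edge-seers (≢-sym i≢i₀) (≢j T₁i₀) (≢j T₁i) heavy₀ heavy (≢-sym h≢g) g-sees h-sees)
    unseen : ∀ l → arcs adj (inEdge (M l)) (inTri (T j)) ≤ 3
    unseen l with M-seers j l in sees | another-M-seer T₁i₀ l
    ... | false | _                = unseeing-edge-to-T sees
    ... | true  | g , g≢l , g-sees = ⊥-elim (heavy⇒¬two-edge-seers (≢j T₁i₀) heavy₀ g≢l g-sees sees)

  -- only the seer in I of a triangle of T₂ completely joined to T j has neighbours in T j
  I-to-full-T : ∀ {i₀ j} → T₂ i₀ ≡ true → i₀ ≢ j → 9 ≤ arcs adj (inTri (T i₀)) (inTri (T j)) →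
                ∀ {u₁} → u₁ ∈ᴾ uncovered → vertexSeesTri adj u₁ (T i₀) ≡ true →
                arcs adj I (inTri (T j)) ≤ 1 + count I
  I-to-full-T {i₀} {j} T₂i₀ i₀≢j full {u₁} u₁∈ u₁-sees =
    ≤-trans (sum-≤-count* (λ u → eqB u u₁) (1 + count I) row)
            (≤-reflexive (trans (cong (_* (1 + count I)) (count-singleton u₁)) (*-identityˡ _)))
    where
    seer-degree : deg adj (inTri (T j)) u₁ ≤ 1 + count I
    seer-degree with proj₂ (T₂-cases T₂i₀) | vertexSeesTri adj u₁ (T j) in sees
    ... | _             | false = ≤-trans (deg-unseen-triangle adj (T j) (proj₁ T-disjoint j) sees) (s≤s z≤n)
    ... | inj₁ (M₁ , _) | true with count-witness {f = M-seers i₀} M₁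
    ...   | g , g-sees = ⊥-elim (full⇒¬edge-and-I-seer i₀≢j full g-sees u₁∈ sees)
    seer-degree | inj₂ I₂ | true = ≤-trans (≤-trans (deg-≤-count adj (inTri (T j)) u₁) (count-inTri (T j)))
                                          (s≤s (≤-trans I₂ (count-mono (λ u → ∧-fst (I u)))))
    row : ∀ u → count (λ v → I u ∧ inTri (T j) v ∧ adj u v) ≤ bit (eqB u u₁) * (1 + count I)
    row u with I u in Iu | eqB u u₁ in u≡u₁
    ... | false | _     = ≤-trans (≤-reflexive (count-empty {n} (λ _ → refl))) z≤n
    ... | true  | true  rewrite eqB⇒≡ u≡u₁ = ≤-trans seer-degree (≤-reflexive (sym (+-identityʳ _)))
    ... | true  | false = ≤-reflexive (count-empty no-neighbour)
      where
      no-neighbour : ∀ v → inTri (T j) v ∧ adj u v ≡ false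
      no-neighbour v with inTri (T j) v in v∈ | adj u v in uv
      ... | false | _     = refl
      ... | true  | false = refl
      ... | true  | true  =
        ⊥-elim (full⇒¬I-neighbour i₀≢j full u₁∈ u₁-sees (in-I Iu) (eqB-false⇒≢ u≡u₁) (in-tri v∈) uv)

  -- at most one triangle of T₂ is completely joined to a triangle of D₀
  from-T₂-≤ : ∀ {j} → D₀ adj T M j ≡ true →
              (from-T T₂ j ≤ count T₂ * 8 + 1 × arcs adj I (inTri (T j)) ≤ 1 + count I) ⊎
              from-T T₂ j ≤ count T₂ * 8
  from-T₂-≤ {j} D₀j with any? (λ i → (T₂ i Data.Bool.≟ true) ×-dec (9 ≤? arcs adj (inTri (T i)) (inTri (T j))))
  ... | no none = inj₂ (from-family-≤ adj T T₂ _ 8 (λ i T₂i → ≤-pred (≰⇒> (λ full → none (i , T₂i , full)))))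
  ... | yes (i₀ , T₂i₀ , full₀) with T₂⇒I-seer T₂i₀
  ...   | u₁ , u₁∈ , u₁-sees =
    inj₁ (from-family-≤-except adj T T₂ _ 8 1 i₀ light (arcs-triangles-≤9 adj (T i₀) (T j)) ,
          I-to-full-T T₂i₀ (≢j T₂i₀) full₀ u₁∈ u₁-sees)
    where
    ≢j : ∀ {i} → T₂ i ≡ true → i ≢ j
    ≢j T₂i refl = true≢false (trans (sym T₂i) (proj₁ (proj₂ (D₀-cases D₀j))))
    light : ∀ i → T₂ i ≡ true → i ≢ i₀ → arcs adj (inTri (T i)) (inTri (T j)) ≤ 8
    light i T₂i i≢i₀ with 9 ≤? arcs adj (inTri (T i)) (inTri (T j))
    ... | no 9≰ = ≤-pred (≰⇒> 9≰)
    ... | yes full with proj₂ (T₂-cases T₂i)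
    ...   | inj₁ (M₁ , _) with count-witness {f = M-seers i} M₁
    ...     | g , g-sees = ⊥-elim (two-full⇒¬I-and-edge-seer (≢-sym i≢i₀) (≢j T₂i₀) (≢j T₂i) full₀ full
                                     u₁∈ u₁-sees g-sees)
    light i T₂i i≢i₀ | yes full | inj₂ I₂ with count-another {f = I-seers i} I₂ u₁
    ...     | u₂ , u₂≢u₁ , h = ⊥-elim (two-full⇒¬two-I-seers (≢-sym i≢i₀) (≢j T₂i₀) (≢j T₂i) full₀ full
                                 u₁∈ u₁-sees (in-I (∧-fst (I u₂) h)) (∧-snd (I u₂) h) (≢-sym u₂≢u₁))

  I-to-T : ∀ j → arcs adj I (inTri (T j)) ≤ count I * 1 + count (I-seers j) * 2
  I-to-T j = sum-≤-counts I (I-seers j) 1 2 row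
    where
    row : ∀ u → count (λ v → I u ∧ inTri (T j) v ∧ adj u v) ≤ bit (I u) * 1 + bit (I-seers j u) * 2
    row u with I u
    ... | false = ≤-reflexive (count-empty {n} (λ _ → refl))
    ... | true  = vertex-to-triangle adj (T j) (proj₁ T-disjoint j)

  private
    heavy-total : ∀ t m → t * 7 + 2 + m * 3 ≡ 7 * t + (2 + 3 * m)
    heavy-total = solve-∀
    light-total : ∀ t m c → t * 7 + (m * 3 + c) ≡ 7 * t + (c + 3 * m)
    light-total = solve-∀
    full-total : ∀ t i → t * 8 + 1 + (1 + i) ≡ 8 * t + (2 + i)
    full-total = solve-∀
    not-full-total : ∀ t i → t * 8 + (i * 1 + 1 * 2) ≡ 8 * t + (2 + i)
    not-full-total = solve-∀

  T₁M-to : ∀ j → arcs adj (covTris T T₁) (inTri (T j)) + arcs adj (covM M) (inTri (T j)) ≤ from-T T₁ j + from-M j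
  T₁M-to j = +-mono-≤ (from-family-cover adj T T₁ (inTri (T j)) adj-sym)
                      (arcs-⋃ˡ adj-sym (λ l → inEdge (M l)) (inTri (T j)))

  T₁M-to-T₂ : ∀ {j} → T₂ j ≡ true →
              arcs adj (covTris T T₁) (inTri (T j)) + arcs adj (covM M) (inTri (T j)) ≤
              7 * count T₁ + (2 + 3 * m)
  T₁M-to-T₂ {j} T₂j = ≤-trans (T₁M-to j) (by-cases (from-T₁-≤ (proj₁ (T₂-cases T₂j))))
    where
    by-cases : (from-T T₁ j ≤ count T₁ * 7 + 2 × from-M j ≤ m * 3) ⊎ from-T T₁ j ≤ count T₁ * 7 →
               from-T T₁ j + from-M j ≤ 7 * count T₁ + (2 + 3 * m)
    by-cases (inj₁ (T₁-part , M-part)) =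
      ≤-trans (+-mono-≤ T₁-part M-part) (≤-reflexive (heavy-total (count T₁) m))
    by-cases (inj₂ T₁-part) = ≤-trans (+-mono-≤ T₁-part M-part) (≤-reflexive (light-total (count T₁) m 2))
      where
      M-part : from-M j ≤ m * 3 + 2
      M-part = ≤-trans (from-M-≤-T₂ T₂j) (+-monoʳ-≤ (m * 3) (*-monoˡ-≤ 2 (¬T₁⇒≤1-M-seer (proj₁ (T₂-cases T₂j)))))

  T₁M-to-D₀ : ∀ {j} → D₀ adj T M j ≡ true →
              arcs adj (covTris T T₁) (inTri (T j)) + arcs adj (covM M) (inTri (T j)) ≤
              7 * count T₁ + (3 + 3 * m)
  T₁M-to-D₀ {j} D₀j = ≤-trans (T₁M-to j) (by-cases (from-T₁-≤ (proj₁ (D₀-cases D₀j))))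
    where
    by-cases : (from-T T₁ j ≤ count T₁ * 7 + 2 × from-M j ≤ m * 3) ⊎ from-T T₁ j ≤ count T₁ * 7 →
               from-T T₁ j + from-M j ≤ 7 * count T₁ + (3 + 3 * m)
    by-cases (inj₁ (T₁-part , M-part)) = ≤-trans (+-mono-≤ T₁-part M-part)
      (≤-trans (≤-reflexive (heavy-total (count T₁) m)) (+-monoʳ-≤ (7 * count T₁) (n≤1+n _)))
    by-cases (inj₂ T₁-part) = ≤-trans (+-mono-≤ T₁-part M-part) (≤-reflexive (light-total (count T₁) m 3))
      where
      M-part : from-M j ≤ m * 3 + 3
      M-part = ≤-trans (from-M-≤ j) (+-monoʳ-≤ (m * 3) (*-monoˡ-≤ 3 (¬T₁⇒≤1-M-seer (proj₁ (D₀-cases D₀j)))))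

  T₂I-to-D₀ : ∀ {j} → D₀ adj T M j ≡ true →
              arcs adj (covTris T T₂) (inTri (T j)) + arcs adj I (inTri (T j)) ≤ 8 * count T₂ + (2 + count I)
  T₂I-to-D₀ {j} D₀j = ≤-trans (+-mono-≤ (from-family-cover adj T T₂ (inTri (T j)) adj-sym) ≤-refl)
                              (by-cases (from-T₂-≤ D₀j))
    where
    by-cases : (from-T T₂ j ≤ count T₂ * 8 + 1 × arcs adj I (inTri (T j)) ≤ 1 + count I) ⊎
               from-T T₂ j ≤ count T₂ * 8 →
               from-T T₂ j + arcs adj I (inTri (T j)) ≤ 8 * count T₂ + (2 + count I)
    by-cases (inj₁ (T₂-part , I-part)) =
      ≤-trans (+-mono-≤ T₂-part I-part) (≤-reflexive (full-total (count T₂) (count I)))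
    by-cases (inj₂ T₂-part) =
      ≤-trans (+-mono-≤ T₂-part I-part) (≤-reflexive (not-full-total (count T₂) (count I)))
      where
      I-part : arcs adj I (inTri (T j)) ≤ count I * 1 + 1 * 2
      I-part = ≤-trans (I-to-T j) (+-monoʳ-≤ (count I * 1) (*-monoˡ-≤ 2 (proj₂ (proj₂ (D₀-cases D₀j)))))

  private
    per-triangle-total : ∀ q a b → q * (a + b) ≡ a * q + b * q
    per-triangle-total = solve-∀

  no-M-edge : m ≡ 0 → Fin m → ⊥
  no-M-edge refl ()

  I-empty : count I ≡ 0 → ∀ u → I u ≡ false
  I-empty i≡0 u with I u in Iu
  ... | false = refl
  ... | true  = ⊥-elim (1+n≰n (≤-trans (count-positive {f = I} {u} Iu) (≤-reflexive i≡0)))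

  T₁-empty : m ≡ 0 → ∀ i → T₁ i ≡ false
  T₁-empty m≡0 i = cong (2 ≤ᵇ_) (count-empty {f = M-seers i} (⊥-elim ∘ no-M-edge m≡0))

  T₂-empty : count I ≡ 0 → ∀ j → T₂ j ≡ false
  T₂-empty i≡0 j with T₂ j in T₂j
  ... | false = refl
  ... | true with T₂⇒I-seer T₂j
  ...   | u , in-I Iu , _ = ⊥-elim (true≢false (trans (sym Iu) (I-empty i≡0 u)))

  T₁M-vanish : m ≡ 0 → ∀ B → e adj (covTris T T₁) B + e adj (covM M) B ≡ 0
  T₁M-vanish m≡0 B =
    cong₂ _+_ (e-emptyˡ adj-sym (covTris-empty T (T₁-empty m≡0)) B)
              (e-emptyˡ adj-sym (λ v → anyFin-none {f = λ l → inEdge (M l) v} (⊥-elim ∘ no-M-edge m≡0)) B)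

  T₂I-vanish : count I ≡ 0 → ∀ B → e adj (covTris T T₂) B + e adj I B ≡ 0
  T₂I-vanish i≡0 B =
    cong₂ _+_ (e-emptyˡ adj-sym (covTris-empty T (T₂-empty i≡0)) B) (e-emptyˡ adj-sym (I-empty i≡0) B)

  item-l : (1 ≤ m → e adj (covTris T T₁) (covTris T T₂) + e adj (covM M) (covTris T T₂) ≤
                    7 * count T₁ * count T₂ + (2 + 3 * m) * count T₂) ×
           (m ≡ 0 → e adj (covTris T T₁) (covTris T T₂) + e adj (covM M) (covTris T T₂) ≡ 0)
  item-l = (λ _ → ≤-trans (edges-to-family adj-sym _ _ T T₂ _ (λ j → T₁M-to-T₂))
                          (≤-reflexive (per-triangle-total (count T₂) (7 * count T₁) (2 + 3 * m)))) ,
           λ m≡0 → T₁M-vanish m≡0 (covTris T T₂)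

  item-m : ∀ Q → (∀ j → Q j ≡ true → D₀ adj T M j ≡ true) →
           (1 ≤ m → e adj (covTris T T₁) (covTris T Q) + e adj (covM M) (covTris T Q) ≤
                    7 * count T₁ * count Q + (3 + 3 * m) * count Q) ×
           (m ≡ 0 → e adj (covTris T T₁) (covTris T Q) + e adj (covM M) (covTris T Q) ≤ 0)
  item-m Q Q⊆D₀ = (λ _ → ≤-trans (edges-to-family adj-sym _ _ T Q _ (λ j Qj → T₁M-to-D₀ (Q⊆D₀ j Qj)))
                                 (≤-reflexive (per-triangle-total (count Q) (7 * count T₁) (3 + 3 * m)))) ,
                  λ m≡0 → ≤-reflexive (T₁M-vanish m≡0 (covTris T Q))

  item-n : ∀ Q → (∀ j → Q j ≡ true → D₀ adj T M j ≡ true) →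
           (1 ≤ count I → e adj (covTris T T₂) (covTris T Q) + e adj I (covTris T Q) ≤
                          8 * count T₂ * count Q + (2 + count I) * count Q) ×
           (count I ≡ 0 → e adj (covTris T T₂) (covTris T Q) + e adj I (covTris T Q) ≤ 0)
  item-n Q Q⊆D₀ = (λ _ → ≤-trans (edges-to-family adj-sym _ _ T Q _ (λ j Qj → T₂I-to-D₀ (Q⊆D₀ j Qj)))
                                 (≤-reflexive (per-triangle-total (count Q) (8 * count T₂) (2 + count I)))) ,
                  λ i≡0 → ≤-reflexive (T₂I-vanish i≡0 (covTris T Q))

removed-⊆ : ∀ {n k} {adj : Adj n} {T : Fin k → Tri n} {D s} → ValidRun adj T D s →
            ∀ j → inList s j ≡ true → D j ≡ true
removed-⊆ (move {i = i} Di _ run) j j∈ with eqB j i in j≡i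
... | true  rewrite eqB⇒≡ j≡i = Di
... | false = ∧-fst _ (removed-⊆ run j j∈)

remaining-⊆ : ∀ {k} (D : Fin k → Bool) s j → finalD D s j ≡ true → D j ≡ true
remaining-⊆ D []      j j∈ = j∈
remaining-⊆ D (i ∷ s) j j∈ = ∧-fst _ (remaining-⊆ (removeIdx D i) s j j∈)

lemma4p4 : ∀ {n k m} (adj : Adj n) → IsSimpleGraph adj → EdgeMaximal adj k →
           (T : Fin k → Tri n) → IsDisjointTriangles adj T →
           (M : Fin m → Edge n) → IsMaximumMatching adj T M →
           TChoiceOptimal adj T m →
           (s : List (Fin k)) → ValidRun adj T (D₀ adj T M) s →
           BoundsLMN adj T M s
lemma4p4 adj simple (no-k+1 , _) T T-disjoint M (M-matching , _) T-optimal s run =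
  item-l ,
  item-m (inList s) (removed-⊆ run) , item-m (finalD (D₀ adj T M) s) (remaining-⊆ _ s) ,
  item-n (inList s) (removed-⊆ run) , item-n (finalD (D₀ adj T M) s) (remaining-⊆ _ s)
  where open Setting adj simple T T-disjoint M M-matching no-k+1 T-optimal
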